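{- For $n\geq 1$, let $a(n)$ be the sum, over all lattice paths from $(0,0)$ to $(n,n)$ with steps $E=(1,0)$, $N=(0,1)$ that stay weakly below the line $y=x$, of the area of the region below the path (between the path and the $x$-axis). Then the number of edges of the Catalan matroid polytope $\mathcal{P}(\mathcal{M}[E^nN^n,(EN)^n])$ is $a(n)$, and $$a(n)=\frac{n^2}{2}\cdot\frac{1}{n+1}\binom{2n}{n}-\frac{4^n}{2}+\frac14\binom{2n+2}{n+1}.$$
   Context: For lattice paths $P,Q$ from $(0,0)$ to $(m,r)$ with $P$ never above $Q$ (words in $\{E,N\}$, $\alpha^n$ meaning $n$ concatenated copies), $\mathcal{M}[P,Q]$ is the matroid on $[m+r]$ whose bases are the $r$-subsets $B$ such that the lattice path with North steps exactly at the positions in $B$ stays in the region bounded by $P$ and $Q$. The matroid polytope is $\mathcal{P}(\mathcal{M})=\mathrm{conv}\{\sum_{i\in B}e_i : B\text{ a basis}\}$. -}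

module Defs where

open import Data.Bool using (Bool; true; false; if_then_else_; _∧_)
open import Data.Nat using (ℕ; zero; suc; _+_; _*_; _∸_; _≤_; _≤ᵇ_; _≡ᵇ_)
open import Data.Nat.DivMod using (_%_)
open import Data.Integer as ℤ using (ℤ)
open import Data.Fin using (Fin; toℕ)
open import Data.Vec using (Vec; []; _∷_; tabulate)
open import Data.List using (List; []; _∷_; map; filter; length; _++_)
open import Data.Nat.ListAction using (sum)
open import Data.List.Membership.Propositional using (_∈_)
open import Data.List.Relation.Unary.Unique.Propositional using (Unique)
open import Data.Product using (Σ; ∃; _×_; _,_)
open import Function.Bundles using (_⇔_)
open import Relation.Binary.PropositionalEquality using (_≡_; _≢_)
open import Relation.Nullary.Decidable using (Dec)
open import Data.Bool.Properties using (T?)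
open import Data.Bool using (T)

-- A word of length d is a Vec Bool d,
-- with  false = E = (1,0)  and  true = N = (0,1).
-- A word is identified with the subset of [d] of positions of its
-- N steps (position i+1 ↔ index i : Fin d); its indicator vector is
-- obtained by reading true as 1 and false as 0.

Word : ℕ → Set
Word d = Vec Bool d

prefixN : ∀ {d} → ℕ → Word d → ℕ
prefixN zero    _       = 0
prefixN (suc k) []      = 0
prefixN (suc k) (b ∷ w) = (if b then 1 else 0) + prefixN k w

countN : ∀ {d} → Word d → ℕ
countN {d} w = prefixN d w

Between : ∀ {d} → Word d → Word d → Word d → Set
Between {d} P Q R = ∀ k → k ≤ d → (prefixN k P ≤ prefixN k R) × (prefixN k R ≤ prefixN k Q)

-- Bases of the lattice path matroid M[P,Q] on [m+r] (P, Q paths from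
-- (0,0) to (m,r)): the r-subsets B whose path stays between P and Q.
-- A basis is represented by its indicator word.
IsBasis : (m r : ℕ) → Word (m + r) → Word (m + r) → Word (m + r) → Set
IsBasis m r P Q B = (countN B ≡ r) × Between P Q B

χ : ∀ {d} → Word d → Vec ℤ d
χ []          = []
χ (true ∷ w)  = ℤ.+ 1 ∷ χ w
χ (false ∷ w) = ℤ.+ 0 ∷ χ w

dot : ∀ {d} → Vec ℤ d → Vec ℤ d → ℤ
dot []      []      = ℤ.+ 0
dot (a ∷ u) (b ∷ v) = a ℤ.* b ℤ.+ dot u v

-- For the polytope conv{ χ B : V B } (V a set of 0/1 points, all of
-- which are vertices), the segment [χ u, χ v] (u ≠ v) is an edge iff
-- it is a face cut out by some linear functional w, i.e. exactly the
-- two generating points χ u, χ v maximise ⟨w,-⟩.  Integral w suffices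
-- (the polytope is rational).
IsEdge : ∀ {d} → (Word d → Set) → Word d → Word d → Set
IsEdge {d} V u v =
  V u × V v × (u ≢ v) ×
  ∃ λ (w : Vec ℤ d) →
    (dot w (χ u) ≡ dot w (χ v)) ×
    (∀ x → V x → x ≢ u → x ≢ v → dot w (χ x) ℤ.< dot w (χ u))

-- "The polytope conv{χ B : V B} has exactly k edges": the ordered pairs
-- (u , v) spanning an edge form a duplicate-free list of length 2k
-- (each edge {u,v} is listed once in each orientation).
HasEdgeCount : ∀ {d} → (Word d → Set) → ℕ → Set
HasEdgeCount {d} V k =
  Σ (List (Word d × Word d)) λ L →
    Unique L ×
    (∀ u v → ((u , v) ∈ L) ⇔ IsEdge V u v) ×
    (length L ≡ 2 * k)

EⁿNⁿ : (n : ℕ) → Word (n + n)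
EⁿNⁿ n = tabulate λ i → n ≤ᵇ toℕ i

[EN]ⁿ : (n : ℕ) → Word (n + n)
[EN]ⁿ n = tabulate λ i → toℕ i % 2 ≡ᵇ 1

allWords : (d : ℕ) → List (Word d)
allWords zero    = [] ∷ []
allWords (suc d) = map (false ∷_) (allWords d) ++ map (true ∷_) (allWords d)

belowAux : ∀ {d} → ℕ → ℕ → Word d → Bool
belowAux e h []          = true
belowAux e h (false ∷ w) = belowAux (suc e) h w
belowAux e h (true ∷ w)  = (suc h ≤ᵇ e) ∧ belowAux e (suc h) w

isSubdiagonal : (n : ℕ) → Word (n + n) → Bool
isSubdiagonal n w = (countN w ≡ᵇ n) ∧ belowAux 0 0 w

areaAux : ∀ {d} → ℕ → Word d → ℕ
areaAux h []          = 0
areaAux h (false ∷ w) = h + areaAux h w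
areaAux h (true ∷ w)  = areaAux (suc h) w

area : ∀ {d} → Word d → ℕ
area w = areaAux 0 w

a : ℕ → ℕ
a n = sum (map area (filter (λ w → T? (isSubdiagonal n w)) (allWords (n + n))))

module Submission where

-- In a lattice path matroid, bases u, v span an edge iff one
-- arises from the other by moving one N step later: the functional χu + χv
-- cuts out such a pair, and any other pair admits bases x, y between u and v
-- with χx + χy = χu + χv.  The Catalan bases are the subdiagonal paths, which
-- moves preserve, and the moves out of a path are counted by its area.
--
-- Number and total area of ballot words satisfy last-step recurrences, also
-- satisfied by closed forms in binomial coefficients; at L = 2n, c = n these
-- give 4(n+1) a(n) = 2n² C(2n,n) - 2(n+1) 4ⁿ + (n+1) C(2n+2,n+1).

open import Defs

module Sums where
  open import Data.Bool using (Bool; true; false; if_then_else_)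
  open import Data.Bool.Properties using (T?)
  open import Data.Nat using (ℕ; zero; suc; _+_; _*_)
  open import Data.Nat.Properties
    using (+-identityʳ; *-zeroʳ; *-distribˡ-+; +-commutativeSemigroup)
  open import Algebra.Properties.CommutativeSemigroup +-commutativeSemigroup
    using (interchange)
  open import Data.Nat.ListAction using (sum)
  open import Data.Nat.ListAction.Properties using (sum-++)
  open import Data.List using (List; []; _∷_; map; filter; length; _++_; cartesianProduct)
  open import Data.List.Properties using (map-++)
  open import Data.Vec using ([]; _∷_; _∷ʳ_)
  open import Data.Product using (_×_; _,_)
  open import Function using (_∘_)
  open import Relation.Binary.PropositionalEquality
  open ≡-Reasoning

  ∑ : ∀ {a} {A : Set a} → List A → (A → ℕ) → ℕ
  ∑ xs f = sum (map f xs)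

  ind : Bool → ℕ
  ind b = if b then 1 else 0

  ∑-++ : ∀ {a} {A : Set a} (xs ys : List A) (f : A → ℕ) →
         ∑ (xs ++ ys) f ≡ ∑ xs f + ∑ ys f
  ∑-++ xs ys f = trans (cong sum (map-++ f xs ys)) (sum-++ (map f xs) (map f ys))

  ∑-map : ∀ {a b} {A : Set a} {B : Set b} (g : A → B) (xs : List A) (f : B → ℕ) →
          ∑ (map g xs) f ≡ ∑ xs (f ∘ g)
  ∑-map g []       f = refl
  ∑-map g (x ∷ xs) f = cong (f (g x) +_) (∑-map g xs f)

  ∑-cong : ∀ {a} {A : Set a} (xs : List A) {f g : A → ℕ} →
           (∀ x → f x ≡ g x) → ∑ xs f ≡ ∑ xs g
  ∑-cong []       f≗g = refl
  ∑-cong (x ∷ xs) f≗g = cong₂ _+_ (f≗g x) (∑-cong xs f≗g)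

  ∑-zero : ∀ {a} {A : Set a} (xs : List A) → ∑ xs (λ _ → 0) ≡ 0
  ∑-zero []       = refl
  ∑-zero (x ∷ xs) = ∑-zero xs

  ∑-+ : ∀ {a} {A : Set a} (xs : List A) (f g : A → ℕ) →
        ∑ xs (λ x → f x + g x) ≡ ∑ xs f + ∑ xs g
  ∑-+ []       f g = refl
  ∑-+ (x ∷ xs) f g = trans (cong (f x + g x +_) (∑-+ xs f g))
                           (interchange (f x) (g x) (∑ xs f) (∑ xs g))

  ∑-* : ∀ {a} {A : Set a} (xs : List A) (c : ℕ) (f : A → ℕ) →
        ∑ xs (λ x → c * f x) ≡ c * ∑ xs f
  ∑-* []       c f = sym (*-zeroʳ c)
  ∑-* (x ∷ xs) c f = trans (cong (c * f x +_) (∑-* xs c f))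
                           (sym (*-distribˡ-+ c (f x) (∑ xs f)))

  ∑-swap : ∀ {a b} {A : Set a} {B : Set b} (xs : List A) (ys : List B) (f : A → B → ℕ) →
           ∑ xs (λ x → ∑ ys (f x)) ≡ ∑ ys (λ y → ∑ xs (λ x → f x y))
  ∑-swap []       ys f = sym (∑-zero ys)
  ∑-swap (x ∷ xs) ys f = trans (cong (∑ ys (f x) +_) (∑-swap xs ys f))
                               (sym (∑-+ ys (f x) (λ y → ∑ xs (λ x′ → f x′ y))))

  ∑-cartesianProduct : ∀ {a b} {A : Set a} {B : Set b} (xs : List A) (ys : List B)
                       (f : A × B → ℕ) →
                       ∑ (cartesianProduct xs ys) f ≡ ∑ xs (λ x → ∑ ys (λ y → f (x , y)))
  ∑-cartesianProduct []       ys f = refl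
  ∑-cartesianProduct (x ∷ xs) ys f = begin
    ∑ (map (x ,_) ys ++ cartesianProduct xs ys) f
      ≡⟨ ∑-++ (map (x ,_) ys) (cartesianProduct xs ys) f ⟩
    ∑ (map (x ,_) ys) f + ∑ (cartesianProduct xs ys) f
      ≡⟨ cong₂ _+_ (∑-map (x ,_) ys f) (∑-cartesianProduct xs ys f) ⟩
    ∑ ys (λ y → f (x , y)) + ∑ xs (λ x′ → ∑ ys (λ y → f (x′ , y))) ∎

  ∑-filter : ∀ {a} {A : Set a} (p : A → Bool) (g : A → ℕ) (xs : List A) →
             sum (map g (filter (T? ∘ p) xs)) ≡ ∑ xs (λ x → if p x then g x else 0)
  ∑-filter p g []       = refl
  ∑-filter p g (x ∷ xs) with p x
  ... | true  = cong (g x +_) (∑-filter p g xs)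
  ... | false = ∑-filter p g xs

  length-filter : ∀ {a} {A : Set a} (p : A → Bool) (xs : List A) →
                  length (filter (T? ∘ p) xs) ≡ ∑ xs (ind ∘ p)
  length-filter p []       = refl
  length-filter p (x ∷ xs) with p x
  ... | true  = cong suc (length-filter p xs)
  ... | false = length-filter p xs

  ∑-allWords-head : ∀ d (f : Word (suc d) → ℕ) →
    ∑ (allWords (suc d)) f ≡ ∑ (allWords d) (λ w → f (false ∷ w)) + ∑ (allWords d) (λ w → f (true ∷ w))
  ∑-allWords-head d f =
    trans (∑-++ (map (false ∷_) (allWords d)) (map (true ∷_) (allWords d)) f)
          (cong₂ _+_ (∑-map (false ∷_) (allWords d) f) (∑-map (true ∷_) (allWords d) f))

  ∑-allWords-last : ∀ d (f : Word (suc d) → ℕ) →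
    ∑ (allWords (suc d)) f ≡ ∑ (allWords d) (λ v → f (v ∷ʳ false) + f (v ∷ʳ true))
  ∑-allWords-last zero    f = trans (cong (f (false ∷ []) +_) (+-identityʳ _)) (sym (+-identityʳ _))
  ∑-allWords-last (suc d) f = begin
    ∑ (allWords (suc (suc d))) f
      ≡⟨ ∑-allWords-head (suc d) f ⟩
    ∑ (allWords (suc d)) (λ w → f (false ∷ w)) + ∑ (allWords (suc d)) (λ w → f (true ∷ w))
      ≡⟨ cong₂ _+_ (∑-allWords-last d (λ w → f (false ∷ w))) (∑-allWords-last d (λ w → f (true ∷ w))) ⟩
    ∑ (allWords d) (λ v → f (false ∷ (v ∷ʳ false)) + f (false ∷ (v ∷ʳ true)))
      + ∑ (allWords d) (λ v → f (true ∷ (v ∷ʳ false)) + f (true ∷ (v ∷ʳ true)))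
      ≡⟨ ∑-allWords-head d (λ v → f (v ∷ʳ false) + f (v ∷ʳ true)) ⟨
    ∑ (allWords (suc d)) (λ v → f (v ∷ʳ false) + f (v ∷ʳ true)) ∎

module Words where
  open Sums using (ind)
  open import Data.Bool using (Bool; true; false; _∧_; T)
  open import Data.Bool.Properties using (∧-identityʳ; ∧-assoc; T-∧)
  open import Data.Nat using (ℕ; suc; _+_; _≤_; _≤ᵇ_)
  open import Data.Nat.Properties
    using (+-suc; +-assoc; +-identityʳ; m≤n⇒m≤1+n; ≤ᵇ⇒≤; +-commutativeSemigroup)
  open import Algebra.Properties.CommutativeSemigroup +-commutativeSemigroup using (x∙yz≈y∙xz)
  open import Data.Vec using ([]; _∷_; _∷ʳ_)
  open import Data.Product using (_×_; _,_)
  open import Function.Bundles using (Equivalence)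
  open import Relation.Binary.PropositionalEquality
  open ≡-Reasoning

  T-∧⁻ : ∀ {x y} → T (x ∧ y) → T x × T y
  T-∧⁻ = Equivalence.to T-∧

  countE : ∀ {d} → Word d → ℕ
  countE []          = 0
  countE (false ∷ w) = suc (countE w)
  countE (true ∷ w)  = countE w

  countN+countE : ∀ {d} (w : Word d) → countN w + countE w ≡ d
  countN+countE []          = refl
  countN+countE (false ∷ w) = trans (+-suc (countN w) (countE w)) (cong suc (countN+countE w))
  countN+countE (true ∷ w)  = cong suc (countN+countE w)

  countN-∷ʳE : ∀ {d} (v : Word d) → countN (v ∷ʳ false) ≡ countN v
  countN-∷ʳE []      = refl
  countN-∷ʳE (b ∷ v) = cong (ind b +_) (countN-∷ʳE v)

  countN-∷ʳN : ∀ {d} (v : Word d) → countN (v ∷ʳ true) ≡ suc (countN v)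
  countN-∷ʳN []      = refl
  countN-∷ʳN (b ∷ v) = trans (cong (ind b +_) (countN-∷ʳN v)) (+-suc (ind b) (countN v))

  areaAux-∷ʳE : ∀ {d} h (v : Word d) → areaAux h (v ∷ʳ false) ≡ areaAux h v + (h + countN v)
  areaAux-∷ʳE h []          = refl
  areaAux-∷ʳE h (false ∷ v) = trans (cong (h +_) (areaAux-∷ʳE h v)) (sym (+-assoc h (areaAux h v) _))
  areaAux-∷ʳE h (true ∷ v)  = trans (areaAux-∷ʳE (suc h) v)
                                    (cong (areaAux (suc h) v +_) (sym (+-suc h (countN v))))

  areaAux-∷ʳN : ∀ {d} h (v : Word d) → areaAux h (v ∷ʳ true) ≡ areaAux h v
  areaAux-∷ʳN h []          = refl
  areaAux-∷ʳN h (false ∷ v) = cong (h +_) (areaAux-∷ʳN h v)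
  areaAux-∷ʳN h (true ∷ v)  = areaAux-∷ʳN (suc h) v

  areaAux-suc : ∀ {d} h (w : Word d) → areaAux (suc h) w ≡ countE w + areaAux h w
  areaAux-suc h []          = refl
  areaAux-suc h (false ∷ w) = begin
    suc h + areaAux (suc h) w      ≡⟨ cong (suc h +_) (areaAux-suc h w) ⟩
    suc h + (countE w + areaAux h w) ≡⟨ cong suc (x∙yz≈y∙xz h (countE w) (areaAux h w)) ⟩
    suc (countE w) + (h + areaAux h w) ∎
  areaAux-suc h (true ∷ w)  = areaAux-suc (suc h) w

  belowAux-∷ʳE : ∀ {d} e h (v : Word d) → belowAux e h (v ∷ʳ false) ≡ belowAux e h v
  belowAux-∷ʳE e h []          = refl
  belowAux-∷ʳE e h (false ∷ v) = belowAux-∷ʳE (suc e) h v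
  belowAux-∷ʳE e h (true ∷ v)  = cong ((suc h ≤ᵇ e) ∧_) (belowAux-∷ʳE e (suc h) v)

  belowAux-∷ʳN : ∀ {d} e h (v : Word d) →
                 belowAux e h (v ∷ʳ true) ≡ belowAux e h v ∧ (suc (h + countN v) ≤ᵇ e + countE v)
  belowAux-∷ʳN e h []
    rewrite +-identityʳ h | +-identityʳ e = ∧-identityʳ (suc h ≤ᵇ e)
  belowAux-∷ʳN e h (false ∷ v) =
    trans (belowAux-∷ʳN (suc e) h v)
          (cong (λ z → belowAux (suc e) h v ∧ (suc (h + countN v) ≤ᵇ z)) (sym (+-suc e (countE v))))
  belowAux-∷ʳN e h (true ∷ v)
    rewrite belowAux-∷ʳN e (suc h) v | +-suc h (countN v) =
    sym (∧-assoc (suc h ≤ᵇ e) (belowAux e (suc h) v) _)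

  belowAux-bound : ∀ {d} e h (w : Word d) → h ≤ e → T (belowAux e h w) →
                   h + countN w ≤ e + countE w
  belowAux-bound e h []          h≤e _ = subst₂ _≤_ (sym (+-identityʳ h)) (sym (+-identityʳ e)) h≤e
  belowAux-bound e h (false ∷ w) h≤e t =
    subst (h + countN w ≤_) (sym (+-suc e (countE w)))
          (belowAux-bound (suc e) h w (m≤n⇒m≤1+n h≤e) t)
  belowAux-bound e h (true ∷ w)  h≤e t with T-∧⁻ {suc h ≤ᵇ e} t
  ... | step , rest =
    subst (_≤ e + countE w) (sym (+-suc h (countN w)))
          (belowAux-bound e (suc h) w (≤ᵇ⇒≤ (suc h) e step) rest)

module BallotWords where
  open Sums
  open Words
  open import Data.Bool using (Bool; true; false; if_then_else_; _∧_; T)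
  open import Data.Bool.Properties using (∧-identityʳ; T-≡)
  open import Data.Nat using (ℕ; suc; _+_; _*_; _≤_; _<_; _≡ᵇ_; z≤n; s≤s)
  open import Data.Nat.Properties
    using (+-suc; ≤-pred; ≤-refl; <⇒≤; m≤n⇒m≤1+n; +-identityʳ; *-zeroʳ; *-identityʳ; ≡ᵇ⇒≡; ≤⇒≤ᵇ;
           +-cancelʳ-≤; +-comm; +-monoʳ-≤; <⇒≱)
  open import Data.Vec using (_∷ʳ_)
  open import Data.Product using (proj₁; proj₂)
  open import Data.Empty using (⊥-elim)
  open import Function.Bundles using (Equivalence)
  open import Relation.Nullary using (¬_)
  open import Relation.Binary.PropositionalEquality
  open ≡-Reasoning

  ballotᵇ : ∀ {L} → ℕ → Word L → Bool
  ballotᵇ c w = (countN w ≡ᵇ c) ∧ belowAux 0 0 w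

  ballot : ℕ → ℕ → ℕ
  ballot L c = ∑ (allWords L) (λ w → ind (ballotᵇ c w))

  areaSum : ℕ → ℕ → ℕ
  areaSum L c = ∑ (allWords L) (λ w → if ballotᵇ c w then area w else 0)

  a≡areaSum : ∀ n → a n ≡ areaSum (n + n) n
  a≡areaSum n = ∑-filter (isSubdiagonal n) area (allWords (n + n))

  ballotᵇ-countN : ∀ {L} c (w : Word L) → T (ballotᵇ c w) → countN w ≡ c
  ballotᵇ-countN c w t = ≡ᵇ⇒≡ (countN w) c (proj₁ (T-∧⁻ t))

  -- A ballot word has at least as many E steps as N steps, so none has length < 2c.
  ballotᵇ-vanish : ∀ {L} c (w : Word L) → L < c + c → ballotᵇ c w ≡ false
  ballotᵇ-vanish {L} c w L<2c with ballotᵇ c w in eq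
  ... | false = refl
  ... | true  = ⊥-elim (<⇒≱ L<2c 2c≤L)
    where
    t : T (ballotᵇ c w)
    t = Equivalence.from T-≡ eq
    cnt : countN w ≡ c
    cnt = ballotᵇ-countN c w t
    2c≤L : c + c ≤ L
    2c≤L = subst₂ (λ x y → c + x ≤ y) cnt (trans (cong (_+ countE w) (sym cnt)) (countN+countE w))
                  (+-monoʳ-≤ c (belowAux-bound 0 0 w z≤n (proj₂ (T-∧⁻ t))))

  ballotᵇ-∷ʳE : ∀ {L} c (v : Word L) → ballotᵇ c (v ∷ʳ false) ≡ ballotᵇ c v
  ballotᵇ-∷ʳE c v = cong₂ (λ k b → (k ≡ᵇ c) ∧ b) (countN-∷ʳE v) (belowAux-∷ʳE 0 0 v)

  ballotᵇ-∷ʳN-zero : ∀ {L} (v : Word L) → ballotᵇ 0 (v ∷ʳ true) ≡ false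
  ballotᵇ-∷ʳN-zero v rewrite countN-∷ʳN v = refl

  ballotᵇ-∷ʳN : ∀ {L} c (v : Word L) → suc c + c ≤ L → ballotᵇ (suc c) (v ∷ʳ true) ≡ ballotᵇ c v
  ballotᵇ-∷ʳN {L} c v room rewrite countN-∷ʳN v | belowAux-∷ʳN 0 0 v
    with countN v ≡ᵇ c | ≡ᵇ⇒≡ (countN v) c
  ... | false | _    = refl
  ... | true  | toEq = trans (cong (belowAux 0 0 v ∧_) (Equivalence.to T-≡ (≤⇒≤ᵇ c<E))) (∧-identityʳ _)
    where
    cnt : countN v ≡ c
    cnt = toEq _
    c<E : suc (countN v) ≤ countE v
    c<E = +-cancelʳ-≤ c (suc (countN v)) (countE v)
            (subst₂ (λ x y → suc x + c ≤ y) (sym cnt)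
                    (trans (sym (countN+countE v)) (trans (cong (_+ countE v) cnt) (+-comm c (countE v))))
                    room)

  area-∷ʳE : ∀ {L} c (v : Word L) →
    (if ballotᵇ c (v ∷ʳ false) then area (v ∷ʳ false) else 0)
      ≡ (if ballotᵇ c v then area v else 0) + c * ind (ballotᵇ c v)
  area-∷ʳE c v rewrite ballotᵇ-∷ʳE c v | areaAux-∷ʳE 0 v
    with ballotᵇ c v | ballotᵇ-countN c v
  ... | false | _     = sym (*-zeroʳ c)
  ... | true  | toCnt = cong (area v +_) (trans (toCnt _) (sym (*-identityʳ c)))

  -- The only ballot word without N steps is E…E, whatever its length.
  ballot-step-zero : ∀ L → ballot (suc L) 0 ≡ ballot L 0
  ballot-step-zero L = trans (∑-allWords-last L _) (∑-cong (allWords L) last)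
    where
    last : ∀ v → ind (ballotᵇ 0 (v ∷ʳ false)) + ind (ballotᵇ 0 (v ∷ʳ true)) ≡ ind (ballotᵇ 0 v)
    last v rewrite ballotᵇ-∷ʳE 0 v | ballotᵇ-∷ʳN-zero v = +-identityʳ _

  ballot-step : ∀ L c → suc c + c ≤ L → ballot (suc L) (suc c) ≡ ballot L (suc c) + ballot L c
  ballot-step L c room =
    trans (∑-allWords-last L _) (trans (∑-cong (allWords L) last) (∑-+ (allWords L) _ _))
    where
    last : ∀ v → ind (ballotᵇ (suc c) (v ∷ʳ false)) + ind (ballotᵇ (suc c) (v ∷ʳ true))
               ≡ ind (ballotᵇ (suc c) v) + ind (ballotᵇ c v)
    last v rewrite ballotᵇ-∷ʳE (suc c) v | ballotᵇ-∷ʳN c v room = refl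

  areaSum-step-zero : ∀ L → areaSum (suc L) 0 ≡ areaSum L 0
  areaSum-step-zero L = trans (∑-allWords-last L _) (∑-cong (allWords L) last)
    where
    last : ∀ v → (if ballotᵇ 0 (v ∷ʳ false) then area (v ∷ʳ false) else 0)
                 + (if ballotᵇ 0 (v ∷ʳ true) then area (v ∷ʳ true) else 0)
               ≡ (if ballotᵇ 0 v then area v else 0)
    last v rewrite area-∷ʳE 0 v | ballotᵇ-∷ʳN-zero v = trans (+-identityʳ _) (+-identityʳ _)

  -- Ending with E contributes the area of the prefix plus the height c+1
  -- of the last E step; ending with N contributes the area of the prefix.
  areaSum-step : ∀ L c → suc c + c ≤ L →
    areaSum (suc L) (suc c) ≡ areaSum L (suc c) + suc c * ballot L (suc c) + areaSum L c
  areaSum-step L c room = begin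
    areaSum (suc L) (suc c)
      ≡⟨ ∑-allWords-last L _ ⟩
    ∑ W (λ v → (if ballotᵇ (suc c) (v ∷ʳ false) then area (v ∷ʳ false) else 0)
               + (if ballotᵇ (suc c) (v ∷ʳ true) then area (v ∷ʳ true) else 0))
      ≡⟨ ∑-cong W last ⟩
    ∑ W (λ v → (A v + suc c * ind (ballotᵇ (suc c) v)) + (if ballotᵇ c v then area v else 0))
      ≡⟨ ∑-+ W _ _ ⟩
    ∑ W (λ v → A v + suc c * ind (ballotᵇ (suc c) v)) + areaSum L c
      ≡⟨ cong (_+ areaSum L c) (trans (∑-+ W _ _) (cong (areaSum L (suc c) +_) (∑-* W (suc c) _))) ⟩
    areaSum L (suc c) + suc c * ballot L (suc c) + areaSum L c ∎
    where
    W = allWords L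
    A : Word L → ℕ
    A v = if ballotᵇ (suc c) v then area v else 0
    last : ∀ v → (if ballotᵇ (suc c) (v ∷ʳ false) then area (v ∷ʳ false) else 0)
                 + (if ballotᵇ (suc c) (v ∷ʳ true) then area (v ∷ʳ true) else 0)
               ≡ (A v + suc c * ind (ballotᵇ (suc c) v)) + (if ballotᵇ c v then area v else 0)
    last v rewrite area-∷ʳE (suc c) v | ballotᵇ-∷ʳN c v room | areaAux-∷ʳN 0 v = refl

  ballot-vanish : ∀ L c → L < c + c → ballot L c ≡ 0
  ballot-vanish L c L<2c =
    trans (∑-cong (allWords L) (λ w → cong ind (ballotᵇ-vanish c w L<2c))) (∑-zero (allWords L))

  areaSum-vanish : ∀ L c → L < c + c → areaSum L c ≡ 0
  areaSum-vanish L c L<2c =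
    trans (∑-cong (allWords L) (λ w → cong (λ b → if b then area w else 0) (ballotᵇ-vanish c w L<2c)))
          (∑-zero (allWords L))

  -- Bookkeeping for the range c + c ≤ L + 1 in which ballot words are counted
  -- by closed formulas: stepping from (L, c) to (L+1, c+1) stays inside it.
  range-halve : ∀ L c → suc c + suc c ≤ suc (suc L) → c + c ≤ L
  range-halve L c h = ≤-pred (subst (_≤ suc L) (+-suc c c) (≤-pred h))

  range-next : ∀ L c → suc c + c ≤ L → suc c + suc c ≤ suc L
  range-next L c room = subst (_≤ suc L) (cong suc (sym (+-suc c c))) (s≤s room)

  range-same : ∀ L c → suc c + c ≤ L → c + c ≤ suc L
  range-same L c room = m≤n⇒m≤1+n (<⇒≤ room)

  range-beyond : ∀ c → suc (c + c) < suc c + suc c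
  range-beyond c = s≤s (subst (suc (c + c) ≤_) (sym (+-suc c c)) ≤-refl)

  range-empty : ∀ c → ¬ (suc c + suc c ≤ 1)
  range-empty c h with subst (_≤ 0) (+-suc c c) (≤-pred h)
  ... | ()

module Binomials where
  open import Data.Nat using (ℕ; zero; suc; _+_; _*_; _^_; s≤s)
  open import Data.Nat.Properties using (+-suc; +-comm; +-identityʳ; *-identityʳ; *-zeroʳ;
    *-distribˡ-+; +-cancelˡ-≡; m≤m+n; m+n∸m≡n)
  open import Data.Nat.Combinatorics using (_C_; nCk+nC[k+1]≡[n+1]C[k+1]; nCk≡nC[n∸k]; nC1≡n)
  open import Data.Nat.Tactic.RingSolver using (solve-∀)
  open import Relation.Binary.PropositionalEquality
  open ≡-Reasoning

  -- binomPrev n k = C(n, k-1), with C(n, -1) = 0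
  binomPrev : ℕ → ℕ → ℕ
  binomPrev n zero    = 0
  binomPrev n (suc k) = n C k

  binomPrefix : ℕ → ℕ → ℕ
  binomPrefix n zero    = 1
  binomPrefix n (suc k) = binomPrefix n k + n C suc k

  -- Pascal's rule, written with binomPrev so that it also covers k = 0.
  pascal : ∀ n k → suc n C k ≡ binomPrev n k + n C k
  pascal n zero    = refl
  pascal n (suc k) = sym (nCk+nC[k+1]≡[n+1]C[k+1] n k)

  binomPrefix-pascal : ∀ n k → binomPrefix (suc n) (suc k) ≡ binomPrefix n k + binomPrefix n (suc k)
  binomPrefix-pascal n zero    = cong suc (pascal n 1)
  binomPrefix-pascal n (suc k) = begin
    binomPrefix (suc n) (suc k) + suc n C suc (suc k)
      ≡⟨ cong₂ _+_ (binomPrefix-pascal n k) (pascal n (suc (suc k))) ⟩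
    (binomPrefix n k + binomPrefix n (suc k)) + (n C suc k + n C suc (suc k))
      ≡⟨ regroup (binomPrefix n k) (binomPrefix n (suc k)) (n C suc k) (n C suc (suc k)) ⟩
    binomPrefix n (suc k) + ((binomPrefix n k + n C suc k) + n C suc (suc k)) ∎
    where
    regroup : ∀ p q x y → (p + q) + (x + y) ≡ q + ((p + x) + y)
    regroup = solve-∀

  binomPrefix-double : ∀ n k → binomPrefix (suc n) k + n C k ≡ binomPrefix n k + binomPrefix n k
  binomPrefix-double n zero    = refl
  binomPrefix-double n (suc k) = begin
    binomPrefix (suc n) (suc k) + n C suc k
      ≡⟨ cong (_+ n C suc k) (binomPrefix-pascal n k) ⟩
    binomPrefix n k + binomPrefix n (suc k) + n C suc k
      ≡⟨ regroup (binomPrefix n k) (binomPrefix n (suc k)) (n C suc k) ⟩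
    binomPrefix n (suc k) + (binomPrefix n k + n C suc k) ∎
    where
    regroup : ∀ p q x → p + q + x ≡ q + (p + x)
    regroup = solve-∀

  central-symmetry : ∀ c → suc (c + c) C suc c ≡ suc (c + c) C c
  central-symmetry c = trans (nCk≡nC[n∸k] (s≤s (m≤m+n c c))) (cong (suc (c + c) C_) (m+n∸m≡n c c))

  central-double : ∀ n → suc (suc (n + n)) C suc n ≡ suc (n + n) C n + suc (n + n) C n
  central-double n = trans (pascal (suc (n + n)) (suc n)) (cong (suc (n + n) C n +_) (central-symmetry n))

  binomPrefix-central : ∀ n → binomPrefix (suc (n + n)) n ≡ 4 ^ n
  binomPrefix-central zero    = refl
  binomPrefix-central (suc n) = begin
    binomPrefix (suc (suc n + suc n)) (suc n)
      ≡⟨ cong (λ m → binomPrefix (suc m) (suc n)) (+-suc (suc n) n) ⟩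
    binomPrefix (suc (suc M)) (suc n)
      ≡⟨ binomPrefix-pascal (suc M) n ⟩
    binomPrefix (suc M) n + binomPrefix (suc M) (suc n)
      ≡⟨ cong (binomPrefix (suc M) n +_) (binomPrefix-pascal M n) ⟩
    binomPrefix (suc M) n + (binomPrefix M n + (binomPrefix M n + M C suc n))
      ≡⟨ cong (λ x → binomPrefix (suc M) n + (binomPrefix M n + (binomPrefix M n + x))) (central-symmetry n) ⟩
    binomPrefix (suc M) n + (binomPrefix M n + (binomPrefix M n + M C n))
      ≡⟨ regroup (binomPrefix (suc M) n) (binomPrefix M n) (M C n) ⟩
    (binomPrefix (suc M) n + M C n) + binomPrefix M n + binomPrefix M n
      ≡⟨ cong (λ x → x + binomPrefix M n + binomPrefix M n) (binomPrefix-double M n) ⟩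
    binomPrefix M n + binomPrefix M n + binomPrefix M n + binomPrefix M n
      ≡⟨ quadruple (binomPrefix M n) ⟩
    4 * binomPrefix M n
      ≡⟨ cong (4 *_) (binomPrefix-central n) ⟩
    4 ^ suc n ∎
    where
    M = suc (n + n)
    regroup : ∀ p q x → p + (q + (q + x)) ≡ (p + x) + q + q
    regroup = solve-∀
    quadruple : ∀ p → p + p + p + p ≡ 4 * p
    quadruple = solve-∀

  absorption : ∀ N k → suc k * (suc N C suc k) ≡ suc N * (N C k)
  absorption zero    zero    = refl
  absorption zero    (suc k) = *-zeroʳ (suc (suc k))
  absorption (suc N) zero    = trans (+-identityʳ _) (trans (nC1≡n (suc (suc N))) (sym (*-identityʳ (suc (suc N)))))
  absorption (suc N) (suc k) = begin
    suc (suc k) * (suc (suc N) C suc (suc k))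
      ≡⟨ cong (suc (suc k) *_) (sym (nCk+nC[k+1]≡[n+1]C[k+1] (suc N) (suc k))) ⟩
    suc (suc k) * (suc N C suc k + suc N C suc (suc k))
      ≡⟨ split (suc k) (suc N C suc k) (suc N C suc (suc k)) ⟩
    suc k * (suc N C suc k) + suc N C suc k + suc (suc k) * (suc N C suc (suc k))
      ≡⟨ cong₂ (λ x y → x + suc N C suc k + y) (absorption N k) (absorption N (suc k)) ⟩
    suc N * (N C k) + suc N C suc k + suc N * (N C suc k)
      ≡⟨ merge (suc N) (N C k) (N C suc k) (suc N C suc k) ⟩
    suc N * (N C k + N C suc k) + suc N C suc k
      ≡⟨ cong (λ x → suc N * x + suc N C suc k) (nCk+nC[k+1]≡[n+1]C[k+1] N k) ⟩
    suc N * (suc N C suc k) + suc N C suc k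
      ≡⟨ +-comm (suc N * (suc N C suc k)) _ ⟩
    suc (suc N) * (suc N C suc k) ∎
    where
    split : ∀ k x y → suc k * (x + y) ≡ k * x + x + suc k * y
    split = solve-∀
    merge : ∀ m x y z → m * x + z + m * y ≡ m * (x + y) + z
    merge = solve-∀

  absorption-central : ∀ n → suc n * binomPrev (n + n) n ≡ n * ((n + n) C n)
  absorption-central zero    = refl
  absorption-central (suc m) = +-cancelˡ-≡ (suc m * X) _ _ (begin
    suc m * X + suc (suc m) * X       ≡⟨ collect (suc m) X ⟩
    suc (suc m + suc m) * X           ≡⟨ absorption (suc m + suc m) m ⟨
    suc m * (suc (suc m + suc m) C suc m)
      ≡⟨ cong (suc m *_) (nCk+nC[k+1]≡[n+1]C[k+1] (suc m + suc m) m) ⟨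
    suc m * (X + Y)                   ≡⟨ *-distribˡ-+ (suc m) X Y ⟩
    suc m * X + suc m * Y ∎)
    where
    X = (suc m + suc m) C m
    Y = (suc m + suc m) C suc m
    collect : ∀ n x → n * x + suc n * x ≡ suc (n + n) * x
    collect = solve-∀

-- Closed forms for ballot numbers and their area sums, valid for 2c ≤ L + 1:
--   ballot L c      = C(L,c) - C(L,c-1),
--   4 · areaSum L c = areaPoly L c (ballot L c) (Σ_{j≤c} C(L+1,j)) C(L+1,c).
-- The right-hand sides satisfy the recurrences of BallotWords (by Pascal's
-- rule and a polynomial identity) and vanish on the line L = 2c - 1, so the
-- identities follow by induction on L.
module ClosedForm where
  open BallotWords
  open Binomials
  open import Data.Nat as ℕ using (ℕ; zero; suc; _≤_; z≤n)
  open import Data.Nat.Properties using (m≤n⇒m<n∨m≡n)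
  open import Data.Nat.Combinatorics using (_C_)
  open import Data.Integer using (ℤ; +_; _+_; _-_; _*_)
  open import Data.Integer.Properties using (pos-+; pos-*)
  open import Data.Integer.Tactic.RingSolver using (solve-∀)
  open import Data.Integer.Solver using (module +-*-Solver)
  open +-*-Solver using (Polynomial; con; var; _:+_; _:*_; _:-_; ⟦_⟧; _:=_; solve)
  open import Data.Fin using () renaming (zero to #0; suc to #s)
  open import Data.Vec using ([]; _∷_)
  open import Data.Sum using (inj₁; inj₂)
  open import Data.Empty using (⊥-elim)
  open import Relation.Binary.PropositionalEquality
  open ≡-Reasoning

  -- The polynomial expressing 4 · areaSum L c in terms of l = L, k = c,
  -- B = ballot L c, P = Σ_{j≤c} C(L+1,j) and C = C(L+1,c), written in the
  -- ring solver's syntax so that identities between its instances can be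
  -- checked by normalisation.
  areaPolyᵉ : ∀ {m} → (l k B P C : Polynomial m) → Polynomial m
  areaPolyᵉ l k B P C =
      (l :* (l :+ con (+ 1)) :- con (+ 2) :* k :* (k :+ con (+ 1))) :* B
    :- con (+ 2) :* (l :- con (+ 2) :* k :+ con (+ 1)) :* P
    :- ((l :- con (+ 2) :* k) :* (l :- con (+ 2) :* k :- con (+ 1)) :- con (+ 2)) :* C

  areaPoly : ℤ → ℤ → ℤ → ℤ → ℤ → ℤ
  areaPoly l k B P C =
    ⟦ areaPolyᵉ (var #0) (var (#s #0)) (var (#s (#s #0))) (var (#s (#s (#s #0)))) (var (#s (#s (#s (#s #0))))) ⟧
      (l ∷ k ∷ B ∷ P ∷ C ∷ [])

  areaPoly-cong : ∀ l k {B B′ P P′ C C′} → B ≡ B′ → P ≡ P′ → C ≡ C′ →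
                  areaPoly l k B P C ≡ areaPoly l k B′ P′ C′
  areaPoly-cong l k refl refl refl = refl

  ballotF : ℕ → ℕ → ℤ
  ballotF L c = + (L C c) - + binomPrev L c

  areaF : ℕ → ℕ → ℤ
  areaF L c = areaPoly (+ L) (+ c) (ballotF L c) (+ binomPrefix (suc L) c) (+ (suc L C c))

  +pascal : ∀ n k → + (suc n C k) ≡ + binomPrev n k + + (n C k)
  +pascal n k = trans (cong +_ (pascal n k)) (pos-+ (binomPrev n k) (n C k))

  ballotF-step : ∀ L c → ballotF L (suc c) + ballotF L c ≡ ballotF (suc L) (suc c)
  ballotF-step L c = begin
    (X - Y) + (Y - Z)    ≡⟨ telescope X Y Z ⟩
    (Y + X) - (Z + Y)    ≡⟨ cong₂ _-_ (+pascal L (suc c)) (+pascal L c) ⟨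
    ballotF (suc L) (suc c) ∎
    where
    X = + (L C suc c)
    Y = + (L C c)
    Z = + binomPrev L c
    telescope : ∀ x y z → (x - y) + (y - z) ≡ (y + x) - (z + y)
    telescope = solve-∀

  -- The polynomial identity behind the area recurrence: X, Y, Z stand for
  -- C(L,c+1), C(L,c), C(L,c-1) and P₀ for Σ_{j≤c} C(L+1,j).
  areaPoly-step : ∀ l k X Y Z P₀ →
    areaPoly (+ 1 + l) (+ 1 + k) (Y + X - (Z + Y)) (P₀ + (P₀ + (Y + X))) ((Z + Y) + (Y + X))
      ≡ areaPoly l (+ 1 + k) (X - Y) (P₀ + (Y + X)) (Y + X) + + 4 * (+ 1 + k) * (X - Y)
        + areaPoly l k (Y - Z) P₀ (Z + Y)
  areaPoly-step = solve 6 (λ l k X Y Z P₀ →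
      areaPolyᵉ (con (+ 1) :+ l) (con (+ 1) :+ k) (Y :+ X :- (Z :+ Y)) (P₀ :+ (P₀ :+ (Y :+ X)))
                ((Z :+ Y) :+ (Y :+ X))
    := areaPolyᵉ l (con (+ 1) :+ k) (X :- Y) (P₀ :+ (Y :+ X)) (Y :+ X) :+ con (+ 4) :* (con (+ 1) :+ k) :* (X :- Y)
       :+ areaPolyᵉ l k (Y :- Z) P₀ (Z :+ Y)) refl

  areaF-step : ∀ L c →
    areaF L (suc c) + + 4 * + suc c * ballotF L (suc c) + areaF L c ≡ areaF (suc L) (suc c)
  areaF-step L c = begin
    areaF L (suc c) + + 4 * + suc c * ballotF L (suc c) + areaF L c
      ≡⟨ cong₂ (λ u v → u + + 4 * + suc c * (X - Y) + v)
               (areaPoly-cong (+ L) (+ suc c) refl prefix rowX)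
               (areaPoly-cong (+ L) (+ c) refl refl rowY) ⟩
    areaPoly (+ L) (+ suc c) (X - Y) (P₀ + (Y + X)) (Y + X) + + 4 * + suc c * (X - Y)
      + areaPoly (+ L) (+ c) (Y - Z) P₀ (Z + Y)
      ≡⟨ areaPoly-step (+ L) (+ c) X Y Z P₀ ⟨
    areaPoly (+ suc L) (+ suc c) (Y + X - (Z + Y)) (P₀ + (P₀ + (Y + X))) ((Z + Y) + (Y + X))
      ≡⟨ areaPoly-cong (+ suc L) (+ suc c) (cong₂ _-_ rowX rowY) prefix′ row′ ⟨
    areaF (suc L) (suc c) ∎
    where
    X = + (L C suc c)
    Y = + (L C c)
    Z = + binomPrev L c
    P₀ = + binomPrefix (suc L) c
    rowX : + (suc L C suc c) ≡ Y + X
    rowX = +pascal L (suc c)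
    rowY : + (suc L C c) ≡ Z + Y
    rowY = +pascal L c
    prefix : + binomPrefix (suc L) (suc c) ≡ P₀ + (Y + X)
    prefix = trans (pos-+ (binomPrefix (suc L) c) _) (cong (λ x → P₀ + x) rowX)
    prefix′ : + binomPrefix (suc (suc L)) (suc c) ≡ P₀ + (P₀ + (Y + X))
    prefix′ = begin
      + binomPrefix (suc (suc L)) (suc c)                       ≡⟨ cong +_ (binomPrefix-pascal (suc L) c) ⟩
      + (binomPrefix (suc L) c ℕ.+ binomPrefix (suc L) (suc c)) ≡⟨ pos-+ (binomPrefix (suc L) c) _ ⟩
      P₀ + + binomPrefix (suc L) (suc c)                        ≡⟨ cong (λ x → P₀ + x) prefix ⟩
      P₀ + (P₀ + (Y + X)) ∎
    row′ : + (suc (suc L) C suc c) ≡ (Z + Y) + (Y + X)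
    row′ = trans (+pascal (suc L) (suc c)) (cong₂ _+_ rowY rowX)

  areaF-zero : ∀ L → areaF L 0 ≡ + 0
  areaF-zero L = identity (+ L)
    where
    identity : ∀ l → areaPoly l (+ 0) (+ 1) (+ 1) (+ 1) ≡ + 0
    identity = solve 1 (λ l → areaPolyᵉ l (con (+ 0)) (con (+ 1)) (con (+ 1)) (con (+ 1)) := con (+ 0)) refl

  -- On the line L = 2c - 1 there are no ballot words, and the formulas vanish
  -- as well, by the symmetry C(2c-1, c) = C(2c-1, c-1).
  ballotF-beyond : ∀ c → ballotF (suc (c ℕ.+ c)) (suc c) ≡ + 0
  ballotF-beyond c =
    trans (cong (λ x → + x - + (suc (c ℕ.+ c) C c)) (central-symmetry c)) (cancel (+ (suc (c ℕ.+ c) C c)))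
    where
    cancel : ∀ x → x - x ≡ + 0
    cancel = solve-∀

  areaF-beyond : ∀ c → areaF (suc (c ℕ.+ c)) (suc c) ≡ + 0
  areaF-beyond c =
    trans (areaPoly-cong (+ suc (c ℕ.+ c)) (+ suc c) (ballotF-beyond c) refl refl) (identity (+ c) _ _)
    where
    identity : ∀ k P C → areaPoly (+ 1 + (k + k)) (+ 1 + k) (+ 0) P C ≡ + 0
    identity = solve 3 (λ k P C →
      areaPolyᵉ (con (+ 1) :+ (k :+ k)) (con (+ 1) :+ k) (con (+ 0)) P C := con (+ 0)) refl

  ballot-closed : ∀ L c → c ℕ.+ c ≤ suc L → + ballot L c ≡ ballotF L c
  ballot-closed zero    zero    _ = refl
  ballot-closed zero    (suc c) h = ⊥-elim (range-empty c h)
  ballot-closed (suc L) zero    _ = trans (cong +_ (ballot-step-zero L)) (ballot-closed L zero z≤n)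
  ballot-closed (suc L) (suc c) h with m≤n⇒m<n∨m≡n (range-halve L c h)
  ... | inj₁ room = begin
    + ballot (suc L) (suc c)              ≡⟨ cong +_ (ballot-step L c room) ⟩
    + (ballot L (suc c) ℕ.+ ballot L c)   ≡⟨ pos-+ (ballot L (suc c)) (ballot L c) ⟩
    + ballot L (suc c) + + ballot L c
      ≡⟨ cong₂ _+_ (ballot-closed L (suc c) (range-next L c room)) (ballot-closed L c (range-same L c room)) ⟩
    ballotF L (suc c) + ballotF L c       ≡⟨ ballotF-step L c ⟩
    ballotF (suc L) (suc c) ∎
  ... | inj₂ refl =
    trans (cong +_ (ballot-vanish (suc (c ℕ.+ c)) (suc c) (range-beyond c))) (sym (ballotF-beyond c))

  four-times : ∀ s k b t → + 4 * + (s ℕ.+ k ℕ.* b ℕ.+ t) ≡ + 4 * + s + + 4 * + k * + b + + 4 * + t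
  four-times s k b t = trans (cong (λ x → + 4 * x) cast) (distribute (+ s) (+ k) (+ b) (+ t))
    where
    cast : + (s ℕ.+ k ℕ.* b ℕ.+ t) ≡ + s + + k * + b + + t
    cast = trans (pos-+ (s ℕ.+ k ℕ.* b) t)
                 (cong (λ x → x + + t) (trans (pos-+ s (k ℕ.* b)) (cong (λ x → + s + x) (pos-* k b))))
    distribute : ∀ s k b t → + 4 * (s + k * b + t) ≡ + 4 * s + + 4 * k * b + + 4 * t
    distribute = solve-∀

  areaSum-closed : ∀ L c → c ℕ.+ c ≤ suc L → + 4 * + areaSum L c ≡ areaF L c
  areaSum-closed zero    zero    _ = refl
  areaSum-closed zero    (suc c) h = ⊥-elim (range-empty c h)
  areaSum-closed (suc L) zero    _ =
    trans (cong (λ s → + 4 * + s) (areaSum-step-zero L))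
          (trans (areaSum-closed L zero z≤n) (trans (areaF-zero L) (sym (areaF-zero (suc L)))))
  areaSum-closed (suc L) (suc c) h with m≤n⇒m<n∨m≡n (range-halve L c h)
  ... | inj₁ room = begin
    + 4 * + areaSum (suc L) (suc c)
      ≡⟨ cong (λ s → + 4 * + s) (areaSum-step L c room) ⟩
    + 4 * + (areaSum L (suc c) ℕ.+ suc c ℕ.* ballot L (suc c) ℕ.+ areaSum L c)
      ≡⟨ four-times (areaSum L (suc c)) (suc c) (ballot L (suc c)) (areaSum L c) ⟩
    + 4 * + areaSum L (suc c) + + 4 * + suc c * + ballot L (suc c) + + 4 * + areaSum L c
      ≡⟨ cong₂ _+_ (cong₂ (λ u v → u + + 4 * + suc c * v)
                          (areaSum-closed L (suc c) (range-next L c room))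
                          (ballot-closed L (suc c) (range-next L c room)))
                   (areaSum-closed L c (range-same L c room)) ⟩
    areaF L (suc c) + + 4 * + suc c * ballotF L (suc c) + areaF L c
      ≡⟨ areaF-step L c ⟩
    areaF (suc L) (suc c) ∎
  ... | inj₂ refl =
    trans (cong (λ s → + 4 * + s) (areaSum-vanish (suc (c ℕ.+ c)) (suc c) (range-beyond c)))
          (sym (areaF-beyond c))

module AreaFormula where
  open BallotWords using (areaSum; a≡areaSum)
  open Binomials
  open ClosedForm
  open import Data.Nat as ℕ using (ℕ; suc; _^_)
  open import Data.Nat.Properties using (≤-refl; m≤n⇒m≤1+n; +-comm; +-identityʳ)
  open import Data.Nat.Combinatorics using (_C_)
  open import Data.Integer using (ℤ; +_; -_; _+_; _-_; _*_)
  open import Data.Integer.Properties using (pos-+; pos-*)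
  open import Data.Integer.Tactic.RingSolver using (solve-∀)
  import Data.Nat.Tactic.RingSolver as ℕS
  open import Data.Integer.Solver using (module +-*-Solver)
  open +-*-Solver using (con; _:+_; _:*_; _:-_; _:=_; solve)
  open import Data.Rational.Unnormalised as ℚᵘ using (ℚᵘ; mkℚᵘ; *≡*)
  open import Data.Rational.Unnormalised.Properties as ℚᵘ using ()
  open import Data.Rational as ℚ using (ℚ; _/_; toℚᵘ)
  open import Data.Rational.Properties using (toℚᵘ-injective; toℚᵘ-fromℚᵘ; toℚᵘ-homo-+; toℚᵘ-homo-*; toℚᵘ-homo‿-)
  open import Relation.Binary.PropositionalEquality

  areaPoly-diagonal : ∀ k B P C → areaPoly (k + k) k B P C ≡ + 2 * k * k * B - + 2 * P + + 2 * C
  areaPoly-diagonal = solve 4 (λ k B P C →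
    areaPolyᵉ (k :+ k) k B P C := con (+ 2) :* k :* k :* B :- con (+ 2) :* P :+ con (+ 2) :* C) refl

  four-a : ∀ n → + 4 * + a n ≡ + 2 * + n * + n * (+ ((n ℕ.+ n) C n) - + binomPrev (n ℕ.+ n) n)
                                 - + 2 * + (4 ^ n) + + 2 * + (suc (n ℕ.+ n) C n)
  four-a n = begin
    + 4 * + a n                   ≡⟨ cong (λ x → + 4 * + x) (a≡areaSum n) ⟩
    + 4 * + areaSum (n ℕ.+ n) n   ≡⟨ areaSum-closed (n ℕ.+ n) n (m≤n⇒m≤1+n ≤-refl) ⟩
    areaF (n ℕ.+ n) n             ≡⟨ areaPoly-diagonal (+ n) _ _ _ ⟩
    + 2 * + n * + n * ballotF (n ℕ.+ n) n - + 2 * + binomPrefix (suc (n ℕ.+ n)) n + + 2 * + (suc (n ℕ.+ n) C n)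
      ≡⟨ cong (λ x → + 2 * + n * + n * ballotF (n ℕ.+ n) n - + 2 * + x + + 2 * + (suc (n ℕ.+ n) C n))
              (binomPrefix-central n) ⟩
    + 2 * + n * + n * ballotF (n ℕ.+ n) n - + 2 * + (4 ^ n) + + 2 * + (suc (n ℕ.+ n) C n) ∎
    where open ≡-Reasoning

  eliminate : ∀ k A Cc Cm P C₁ C₂ →
    + 4 * A ≡ + 2 * k * k * (Cc - Cm) - + 2 * P + + 2 * C₁ →
    (+ 1 + k) * Cm ≡ k * Cc → C₂ ≡ C₁ + C₁ →
    + 4 * (+ 1 + k) * A ≡ + 2 * (k * k) * Cc - + 2 * (+ 1 + k) * P + (+ 1 + k) * C₂
  eliminate k A Cc Cm P C₁ C₂ four-A absorbed doubled = begin
    + 4 * (+ 1 + k) * A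
      ≡⟨ factor k A ⟩
    (+ 1 + k) * (+ 4 * A)
      ≡⟨ cong ((+ 1 + k) *_) four-A ⟩
    (+ 1 + k) * (+ 2 * k * k * (Cc - Cm) - + 2 * P + + 2 * C₁)
      ≡⟨ expand k Cc Cm P C₁ ⟩
    + 2 * k * k * ((+ 1 + k) * Cc - (+ 1 + k) * Cm) - + 2 * (+ 1 + k) * P + (+ 1 + k) * (C₁ + C₁)
      ≡⟨ cong₂ (λ x y → + 2 * k * k * ((+ 1 + k) * Cc - x) - + 2 * (+ 1 + k) * P + (+ 1 + k) * y)
               absorbed (sym doubled) ⟩
    + 2 * k * k * ((+ 1 + k) * Cc - k * Cc) - + 2 * (+ 1 + k) * P + (+ 1 + k) * C₂
      ≡⟨ collect k Cc P C₂ ⟩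
    + 2 * (k * k) * Cc - + 2 * (+ 1 + k) * P + (+ 1 + k) * C₂ ∎
    where
    open ≡-Reasoning
    factor : ∀ k A → + 4 * (+ 1 + k) * A ≡ (+ 1 + k) * (+ 4 * A)
    factor = solve-∀
    expand : ∀ k Cc Cm P C₁ →
      (+ 1 + k) * (+ 2 * k * k * (Cc - Cm) - + 2 * P + + 2 * C₁)
        ≡ + 2 * k * k * ((+ 1 + k) * Cc - (+ 1 + k) * Cm) - + 2 * (+ 1 + k) * P + (+ 1 + k) * (C₁ + C₁)
    expand = solve-∀
    collect : ∀ k Cc P C₂ →
      + 2 * k * k * ((+ 1 + k) * Cc - k * Cc) - + 2 * (+ 1 + k) * P + (+ 1 + k) * C₂
        ≡ + 2 * (k * k) * Cc - + 2 * (+ 1 + k) * P + (+ 1 + k) * C₂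
    collect = solve-∀

  two-n : ∀ n → 2 ℕ.* n ≡ n ℕ.+ n
  two-n n = cong (n ℕ.+_) (+-identityʳ n)

  four-succ-a : ∀ n → + 4 * + suc n * + a n
                      ≡ + 2 * + (n ℕ.* n) * + ((2 ℕ.* n) C n) - + 2 * + suc n * + (4 ^ n)
                        + + suc n * + ((2 ℕ.* n ℕ.+ 2) C (n ℕ.+ 1))
  four-succ-a n = begin
    + 4 * + suc n * + a n
      ≡⟨ eliminate (+ n) (+ a n) (+ ((n ℕ.+ n) C n)) (+ binomPrev (n ℕ.+ n) n) (+ (4 ^ n))
                   (+ (suc (n ℕ.+ n) C n)) (+ (suc (suc (n ℕ.+ n)) C suc n))
                   (four-a n)
                   (trans (sym (pos-* (suc n) _)) (trans (cong +_ (absorption-central n)) (pos-* n _)))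
                   (trans (cong +_ (central-double n)) (pos-+ (suc (n ℕ.+ n) C n) _)) ⟩
    + 2 * (+ n * + n) * + ((n ℕ.+ n) C n) - + 2 * + suc n * + (4 ^ n) + + suc n * + (suc (suc (n ℕ.+ n)) C suc n)
      ≡⟨ cong₂ (λ x m → + 2 * x * + (m C n) - + 2 * + suc n * + (4 ^ n) + + suc n * + (suc (suc (n ℕ.+ n)) C suc n))
               (sym (pos-* n n)) (sym (two-n n)) ⟩
    + 2 * + (n ℕ.* n) * + ((2 ℕ.* n) C n) - + 2 * + suc n * + (4 ^ n) + + suc n * + (suc (suc (n ℕ.+ n)) C suc n)
      ≡⟨ cong (λ m → + 2 * + (n ℕ.* n) * + ((2 ℕ.* n) C n) - + 2 * + suc n * + (4 ^ n) + + suc n * + m)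
              (cong₂ _C_ (trans (+-comm _ 2) (cong (2 ℕ.+_) (two-n n))) (+-comm n 1)) ⟨
    + 2 * + (n ℕ.* n) * + ((2 ℕ.* n) C n) - + 2 * + suc n * + (4 ^ n) + + suc n * + ((2 ℕ.* n ℕ.+ 2) C (n ℕ.+ 1)) ∎
    where open ≡-Reasoning

  -- Dividing by 4(n+1) in ℚᵘ: cross-multiplication turns the claim into the
  -- integer identity.
  divide : ∀ (A NN Cc P C₂ : ℤ) (n : ℕ) →
    + 4 * + suc n * A ≡ + 2 * NN * Cc - + 2 * + suc n * P + + suc n * C₂ →
    mkℚᵘ A 0 ℚᵘ.≃ ((mkℚᵘ NN 1 ℚᵘ.* mkℚᵘ (+ 1) n) ℚᵘ.* mkℚᵘ Cc 0 ℚᵘ.- mkℚᵘ P 1) ℚᵘ.+ (mkℚᵘ (+ 1) 3 ℚᵘ.* mkℚᵘ C₂ 0)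
  divide A NN Cc P C₂ n four-succ-A = *≡* (begin
    A * + (2 ℕ.* suc n ℕ.* 1 ℕ.* 2 ℕ.* (4 ℕ.* 1))
      ≡⟨ cong (A *_) (trans (cong +_ (sixteen n)) (pos-* 16 (suc n))) ⟩
    A * (+ 16 * + suc n)
      ≡⟨ scale A (+ suc n) ⟩
    + 4 * (+ 4 * + suc n * A)
      ≡⟨ cong (+ 4 *_) four-succ-A ⟩
    + 4 * (+ 2 * NN * Cc - + 2 * + suc n * P + + suc n * C₂)
      ≡⟨ spread NN Cc P C₂ (+ suc n) ⟩
    (((NN * + 1) * Cc) * + 2 + (- P) * (+ 2 * + suc n)) * + 4 + (+ 1 * C₂) * (+ 4 * + suc n)
      ≡⟨ cong₂ (λ x y → (((NN * + 1) * Cc) * + 2 + (- P) * x) * + 4 + (+ 1 * C₂) * y)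
               (sym (trans (cong +_ (double n)) (pos-* 2 (suc n))))
               (sym (trans (cong +_ (quadruple n)) (pos-* 4 (suc n)))) ⟩
    (((NN * + 1) * Cc) * + 2 + (- P) * + (2 ℕ.* suc n ℕ.* 1)) * + 4 + (+ 1 * C₂) * + (2 ℕ.* suc n ℕ.* 1 ℕ.* 2)
      ≡⟨ times-one _ ⟩
    ((((NN * + 1) * Cc) * + 2 + (- P) * + (2 ℕ.* suc n ℕ.* 1)) * + 4
      + (+ 1 * C₂) * + (2 ℕ.* suc n ℕ.* 1 ℕ.* 2)) * + 1 ∎)
    where
    open ≡-Reasoning
    double : ∀ n → 2 ℕ.* suc n ℕ.* 1 ≡ 2 ℕ.* suc n
    double = ℕS.solve-∀
    quadruple : ∀ n → 2 ℕ.* suc n ℕ.* 1 ℕ.* 2 ≡ 4 ℕ.* suc n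
    quadruple = ℕS.solve-∀
    sixteen : ∀ n → 2 ℕ.* suc n ℕ.* 1 ℕ.* 2 ℕ.* (4 ℕ.* 1) ≡ 16 ℕ.* suc n
    sixteen = ℕS.solve-∀
    scale : ∀ A s → A * (+ 16 * s) ≡ + 4 * (+ 4 * s * A)
    scale = solve-∀
    spread : ∀ NN Cc P C₂ s → + 4 * (+ 2 * NN * Cc - + 2 * s * P + s * C₂)
               ≡ (((NN * + 1) * Cc) * + 2 + (- P) * (+ 2 * s)) * + 4 + (+ 1 * C₂) * (+ 4 * s)
    spread = solve-∀
    times-one : ∀ x → x ≡ x * + 1
    times-one = solve-∀

  toℚᵘ-shape : ∀ p q r s t u →
    toℚᵘ (p ℚ.* q ℚ.* r ℚ.- s ℚ.+ t ℚ.* u)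
      ℚᵘ.≃ ((toℚᵘ p ℚᵘ.* toℚᵘ q) ℚᵘ.* toℚᵘ r ℚᵘ.- toℚᵘ s) ℚᵘ.+ (toℚᵘ t ℚᵘ.* toℚᵘ u)
  toℚᵘ-shape p q r s t u = begin
    toℚᵘ (p ℚ.* q ℚ.* r ℚ.- s ℚ.+ t ℚ.* u)
      ≈⟨ toℚᵘ-homo-+ (p ℚ.* q ℚ.* r ℚ.- s) (t ℚ.* u) ⟩
    toℚᵘ (p ℚ.* q ℚ.* r ℚ.- s) ℚᵘ.+ toℚᵘ (t ℚ.* u)
      ≈⟨ ℚᵘ.+-cong (toℚᵘ-homo-+ (p ℚ.* q ℚ.* r) (ℚ.- s)) (toℚᵘ-homo-* t u) ⟩
    (toℚᵘ (p ℚ.* q ℚ.* r) ℚᵘ.+ toℚᵘ (ℚ.- s)) ℚᵘ.+ (toℚᵘ t ℚᵘ.* toℚᵘ u)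
      ≈⟨ ℚᵘ.+-congˡ (toℚᵘ t ℚᵘ.* toℚᵘ u)
           (ℚᵘ.+-cong (ℚᵘ.≃-trans (toℚᵘ-homo-* (p ℚ.* q) r) (ℚᵘ.*-congʳ (toℚᵘ-homo-* p q))) (toℚᵘ-homo‿- s)) ⟩
    ((toℚᵘ p ℚᵘ.* toℚᵘ q) ℚᵘ.* toℚᵘ r ℚᵘ.- toℚᵘ s) ℚᵘ.+ (toℚᵘ t ℚᵘ.* toℚᵘ u) ∎
    where open ℚᵘ.≃-Reasoning

  toℚᵘ-fraction : ∀ x d → toℚᵘ ((+ x) / suc d) ℚᵘ.≃ mkℚᵘ (+ x) d
  toℚᵘ-fraction x d = toℚᵘ-fromℚᵘ (mkℚᵘ (+ x) d)

  a-formula : ∀ n → (+ a n) / 1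
          ≡ (((+ (n ℕ.* n)) / 2) ℚ.* ((+ 1) / suc n) ℚ.* ((+ ((2 ℕ.* n) C n)) / 1))
            ℚ.- ((+ (4 ^ n)) / 2)
            ℚ.+ (((+ 1) / 4) ℚ.* ((+ ((2 ℕ.* n ℕ.+ 2) C (n ℕ.+ 1))) / 1))
  a-formula n = toℚᵘ-injective (begin
    toℚᵘ ((+ a n) / 1)
      ≈⟨ toℚᵘ-fraction (a n) 0 ⟩
    mkℚᵘ (+ a n) 0
      ≈⟨ divide (+ a n) (+ (n ℕ.* n)) (+ central) (+ (4 ^ n)) (+ central′) n (four-succ-a n) ⟩
    ((mkℚᵘ (+ (n ℕ.* n)) 1 ℚᵘ.* mkℚᵘ (+ 1) n) ℚᵘ.* mkℚᵘ (+ central) 0 ℚᵘ.- mkℚᵘ (+ (4 ^ n)) 1)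
      ℚᵘ.+ (mkℚᵘ (+ 1) 3 ℚᵘ.* mkℚᵘ (+ central′) 0)
      ≈⟨ ℚᵘ.+-cong (ℚᵘ.+-cong (ℚᵘ.*-cong (ℚᵘ.*-cong (toℚᵘ-fraction (n ℕ.* n) 1) (toℚᵘ-fraction 1 n))
                                          (toℚᵘ-fraction central 0))
                              (ℚᵘ.-‿cong (toℚᵘ-fraction (4 ^ n) 1)))
                   (ℚᵘ.*-cong (toℚᵘ-fraction 1 3) (toℚᵘ-fraction central′ 0)) ⟨
    ((toℚᵘ Q₁ ℚᵘ.* toℚᵘ Q₂) ℚᵘ.* toℚᵘ Q₃ ℚᵘ.- toℚᵘ Q₄) ℚᵘ.+ (toℚᵘ Q₅ ℚᵘ.* toℚᵘ Q₆)
      ≈⟨ toℚᵘ-shape Q₁ Q₂ Q₃ Q₄ Q₅ Q₆ ⟨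
    toℚᵘ (Q₁ ℚ.* Q₂ ℚ.* Q₃ ℚ.- Q₄ ℚ.+ Q₅ ℚ.* Q₆) ∎)
    where
    open ℚᵘ.≃-Reasoning
    central = (2 ℕ.* n) C n
    central′ = (2 ℕ.* n ℕ.+ 2) C (n ℕ.+ 1)
    Q₁ = (+ (n ℕ.* n)) / 2
    Q₂ = (+ 1) / suc n
    Q₃ = (+ central) / 1
    Q₄ = (+ (4 ^ n)) / 2
    Q₅ = (+ 1) / 4
    Q₆ = (+ central′) / 1

-- Two elementary relations between words of the same length, decided by
-- boolean functions so that they can be counted:
--   addsNᵇ u v  : v arises from u by turning one E step into an N step;
--   movesNᵇ u v : v arises from u by moving one N step to a later position
--                 (an N at i and an E at j > i are exchanged).
-- The number of v with movesNᵇ u v is the area of u: every E step of u can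
-- receive any of the N steps preceding it.  The statistic common u x counts
-- the positions where both words have an N step; it is the inner product
-- of their indicator vectors.
module Moves where
  open Sums
  open Words
  open import Data.Bool using (Bool; true; false)
  open import Data.Nat using (ℕ; suc; _+_; _≤_; _<_; z≤n; s≤s)
  open import Data.Nat.Properties using (+-comm; +-identityʳ; suc-injective; m≤n⇒m≤1+n;
    m≤n⇒m<n∨m≡n; <-irrefl)
  open import Data.Vec using ([]; _∷_)
  open import Data.Sum using (inj₁; inj₂)
  open import Data.Empty using (⊥-elim)
  open import Relation.Binary.PropositionalEquality

  sameᵇ : ∀ {d} → Word d → Word d → Bool
  sameᵇ []          []          = true
  sameᵇ (false ∷ u) (false ∷ v) = sameᵇ u v
  sameᵇ (true ∷ u)  (true ∷ v)  = sameᵇ u v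
  sameᵇ (false ∷ u) (true ∷ v)  = false
  sameᵇ (true ∷ u)  (false ∷ v) = false

  addsNᵇ : ∀ {d} → Word d → Word d → Bool
  addsNᵇ []          []          = false
  addsNᵇ (false ∷ u) (false ∷ v) = addsNᵇ u v
  addsNᵇ (true ∷ u)  (true ∷ v)  = addsNᵇ u v
  addsNᵇ (false ∷ u) (true ∷ v)  = sameᵇ u v
  addsNᵇ (true ∷ u)  (false ∷ v) = false

  movesNᵇ : ∀ {d} → Word d → Word d → Bool
  movesNᵇ []          []          = false
  movesNᵇ (false ∷ u) (false ∷ v) = movesNᵇ u v
  movesNᵇ (true ∷ u)  (true ∷ v)  = movesNᵇ u v
  movesNᵇ (true ∷ u)  (false ∷ v) = addsNᵇ u v
  movesNᵇ (false ∷ u) (true ∷ v)  = false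

  sameᵇ-refl : ∀ {d} (u : Word d) → sameᵇ u u ≡ true
  sameᵇ-refl []          = refl
  sameᵇ-refl (false ∷ u) = sameᵇ-refl u
  sameᵇ-refl (true ∷ u)  = sameᵇ-refl u

  sameᵇ-sound : ∀ {d} (u v : Word d) → sameᵇ u v ≡ true → u ≡ v
  sameᵇ-sound []          []          _ = refl
  sameᵇ-sound (false ∷ u) (false ∷ v) e = cong (false ∷_) (sameᵇ-sound u v e)
  sameᵇ-sound (true ∷ u)  (true ∷ v)  e = cong (true ∷_) (sameᵇ-sound u v e)

  movesNᵇ-irrefl : ∀ {d} (u : Word d) → movesNᵇ u u ≡ false
  movesNᵇ-irrefl []          = refl
  movesNᵇ-irrefl (false ∷ u) = movesNᵇ-irrefl u
  movesNᵇ-irrefl (true ∷ u)  = movesNᵇ-irrefl u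

  -- The first difference decides the direction of a move.
  movesNᵇ-asym : ∀ {d} (u v : Word d) → movesNᵇ u v ≡ true → movesNᵇ v u ≡ false
  movesNᵇ-asym [] [] ()
  movesNᵇ-asym (false ∷ u) (false ∷ v) e = movesNᵇ-asym u v e
  movesNᵇ-asym (true ∷ u)  (true ∷ v)  e = movesNᵇ-asym u v e
  movesNᵇ-asym (true ∷ u)  (false ∷ v) e = refl

  addsNᵇ-countN : ∀ {d} (u v : Word d) → addsNᵇ u v ≡ true → suc (countN u) ≡ countN v
  addsNᵇ-countN [] [] ()
  addsNᵇ-countN (false ∷ u) (false ∷ v) e = addsNᵇ-countN u v e
  addsNᵇ-countN (true ∷ u)  (true ∷ v)  e = cong suc (addsNᵇ-countN u v e)
  addsNᵇ-countN (false ∷ u) (true ∷ v)  e = cong (λ z → suc (countN z)) (sameᵇ-sound u v e)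

  movesNᵇ-countN : ∀ {d} (u v : Word d) → movesNᵇ u v ≡ true → countN u ≡ countN v
  movesNᵇ-countN [] [] ()
  movesNᵇ-countN (false ∷ u) (false ∷ v) e = movesNᵇ-countN u v e
  movesNᵇ-countN (true ∷ u)  (true ∷ v)  e = cong suc (movesNᵇ-countN u v e)
  movesNᵇ-countN (true ∷ u)  (false ∷ v) e = addsNᵇ-countN u v e

  common : ∀ {d} → Word d → Word d → ℕ
  common []          []          = 0
  common (true ∷ u)  (true ∷ v)  = suc (common u v)
  common (false ∷ u) (false ∷ v) = common u v
  common (true ∷ u)  (false ∷ v) = common u v
  common (false ∷ u) (true ∷ v)  = common u v

  common-self : ∀ {d} (u : Word d) → common u u ≡ countN u
  common-self []          = refl
  common-self (false ∷ u) = common-self u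
  common-self (true ∷ u)  = cong suc (common-self u)

  common-sym : ∀ {d} (u v : Word d) → common u v ≡ common v u
  common-sym []          []          = refl
  common-sym (true ∷ u)  (true ∷ v)  = cong suc (common-sym u v)
  common-sym (false ∷ u) (false ∷ v) = common-sym u v
  common-sym (true ∷ u)  (false ∷ v) = common-sym u v
  common-sym (false ∷ u) (true ∷ v)  = common-sym u v

  common-≤ˡ : ∀ {d} (u v : Word d) → common u v ≤ countN u
  common-≤ˡ []          []          = z≤n
  common-≤ˡ (true ∷ u)  (true ∷ v)  = s≤s (common-≤ˡ u v)
  common-≤ˡ (false ∷ u) (false ∷ v) = common-≤ˡ u v
  common-≤ˡ (true ∷ u)  (false ∷ v) = m≤n⇒m≤1+n (common-≤ˡ u v)
  common-≤ˡ (false ∷ u) (true ∷ v)  = common-≤ˡ u v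

  common-≤ʳ : ∀ {d} (u v : Word d) → common u v ≤ countN v
  common-≤ʳ u v = subst (_≤ countN v) (common-sym v u) (common-≤ˡ v u)

  common-full : ∀ {d} (u x : Word d) → countN x ≡ countN u → common u x ≡ countN u → x ≡ u
  common-full []          []          _ _ = refl
  common-full (true ∷ u)  (true ∷ x)  c e = cong (true ∷_) (common-full u x (suc-injective c) (suc-injective e))
  common-full (false ∷ u) (false ∷ x) c e = cong (false ∷_) (common-full u x c e)
  common-full (true ∷ u)  (false ∷ x) c e = ⊥-elim (<-irrefl refl (subst (_≤ countN u) e (common-≤ˡ u x)))
  common-full (false ∷ u) (true ∷ x)  c e =
    ⊥-elim (<-irrefl refl (subst (_≤ countN x) (trans e (sym c)) (common-≤ʳ u x)))

  common-< : ∀ {d} (u x : Word d) → countN x ≡ countN u → x ≢ u → common u x < countN u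
  common-< u x c x≢u with m≤n⇒m<n∨m≡n (common-≤ˡ u x)
  ... | inj₁ lt = lt
  ... | inj₂ e  = ⊥-elim (x≢u (common-full u x c e))

  addsNᵇ-common : ∀ {d} (u v : Word d) → addsNᵇ u v ≡ true → common u v ≡ countN u
  addsNᵇ-common [] [] ()
  addsNᵇ-common (false ∷ u) (false ∷ v) e = addsNᵇ-common u v e
  addsNᵇ-common (true ∷ u)  (true ∷ v)  e = cong suc (addsNᵇ-common u v e)
  addsNᵇ-common (false ∷ u) (true ∷ v)  e rewrite sameᵇ-sound u v e = common-self v

  movesNᵇ-common : ∀ {d} (u v : Word d) → movesNᵇ u v ≡ true → suc (common u v) ≡ countN u
  movesNᵇ-common [] [] ()
  movesNᵇ-common (false ∷ u) (false ∷ v) e = movesNᵇ-common u v e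
  movesNᵇ-common (true ∷ u)  (true ∷ v)  e = cong suc (movesNᵇ-common u v e)
  movesNᵇ-common (true ∷ u)  (false ∷ v) e = cong suc (addsNᵇ-common u v e)

  count-sameᵇ : ∀ {d} (u : Word d) → ∑ (allWords d) (λ v → ind (sameᵇ u v)) ≡ 1
  count-sameᵇ []                = refl
  count-sameᵇ {suc d} (false ∷ u) =
    trans (∑-allWords-head d _) (trans (cong₂ _+_ (count-sameᵇ u) (∑-zero (allWords d))) refl)
  count-sameᵇ {suc d} (true ∷ u)  =
    trans (∑-allWords-head d _) (cong₂ _+_ (∑-zero (allWords d)) (count-sameᵇ u))

  count-addsNᵇ : ∀ {d} (u : Word d) → ∑ (allWords d) (λ v → ind (addsNᵇ u v)) ≡ countE u
  count-addsNᵇ []                = refl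
  count-addsNᵇ {suc d} (false ∷ u) =
    trans (∑-allWords-head d _) (trans (cong₂ _+_ (count-addsNᵇ u) (count-sameᵇ u)) (+-comm (countE u) 1))
  count-addsNᵇ {suc d} (true ∷ u)  =
    trans (∑-allWords-head d _) (cong₂ _+_ (∑-zero (allWords d)) (count-addsNᵇ u))

  count-movesNᵇ : ∀ {d} (u : Word d) → ∑ (allWords d) (λ v → ind (movesNᵇ u v)) ≡ area u
  count-movesNᵇ []                = refl
  count-movesNᵇ {suc d} (false ∷ u) =
    trans (∑-allWords-head d _) (trans (cong₂ _+_ (count-movesNᵇ u) (∑-zero (allWords d))) (+-identityʳ _))
  count-movesNᵇ {suc d} (true ∷ u)  =
    trans (∑-allWords-head d _) (trans (cong₂ _+_ (count-addsNᵇ u) (count-movesNᵇ u)) (sym (areaAux-suc 0 u)))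

-- If u ≠ v have the same number of N steps and
-- neither arises from the other by a single move, then there are two
-- further words x, y, different from u and v, with the same number of N
-- steps, whose paths stay (prefix by prefix) between those of u and v, and
-- with χ x + χ y = χ u + χ v.  They are found at the first difference of u
-- and v, say u = p N u′, v = p E v′: with j the first position where u′ has
-- E and v′ has N, put x = p E (u′ + {j}) and y = p N (v′ - {j}).
module Exchange where
  open Sums using (ind)
  open Moves
  open import Data.Bool using (Bool; true; false)
  open import Data.Nat using (ℕ; zero; suc; _+_; _≤_; z≤n; s≤s)
  open import Data.Nat.Properties using (+-comm; +-suc; +-cancelˡ-≡; suc-injective; ≤-pred; ≤-trans;
    ≤-reflexive; ≤-total; n≤1+n; m≤n⇒m≤1+n; +-monoʳ-≤; +-commutativeSemigroup)
  open import Algebra.Properties.CommutativeSemigroup +-commutativeSemigroup using (interchange)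
  open import Data.Vec using ([]; _∷_)
  open import Data.Vec.Properties using (∷-injectiveʳ)
  open import Data.Product using (_×_; _,_)
  open import Data.Sum using (_⊎_; inj₁; inj₂)
  open import Data.Empty using (⊥-elim)
  open import Relation.Binary.PropositionalEquality
  open ≡-Reasoning

  raise : ∀ {d} → Word d → Word d → Word d
  raise []          []          = []
  raise (false ∷ u) (true ∷ v)  = true ∷ u
  raise (false ∷ u) (false ∷ v) = false ∷ raise u v
  raise (true ∷ u)  (true ∷ v)  = true ∷ raise u v
  raise (true ∷ u)  (false ∷ v) = true ∷ raise u v

  lower : ∀ {d} → Word d → Word d → Word d
  lower []          []          = []
  lower (false ∷ u) (true ∷ v)  = false ∷ v
  lower (false ∷ u) (false ∷ v) = false ∷ lower u v
  lower (true ∷ u)  (true ∷ v)  = true ∷ lower u v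
  lower (true ∷ u)  (false ∷ v) = false ∷ lower u v

  data SameSum : ∀ {d} → Word d → Word d → Word d → Word d → Set where
    []  : SameSum [] [] [] []
    _∷_ : ∀ {d a b c e} {x y u v : Word d} → ind a + ind b ≡ ind c + ind e →
          SameSum x y u v → SameSum (a ∷ x) (b ∷ y) (c ∷ u) (e ∷ v)

  SameSum-refl : ∀ {d} (u v : Word d) → SameSum u v u v
  SameSum-refl []      []      = []
  SameSum-refl (a ∷ u) (b ∷ v) = refl ∷ SameSum-refl u v

  SameSum-swap : ∀ {d} {x y u v : Word d} → SameSum x y u v → SameSum x y v u
  SameSum-swap [] = []
  SameSum-swap {x = a ∷ _} {b ∷ _} {c ∷ _} {e ∷ _} (p ∷ s) = trans p (+-comm (ind c) (ind e)) ∷ SameSum-swap s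

  SameSum-countN : ∀ {d} {x y u v : Word d} → SameSum x y u v → countN x + countN y ≡ countN u + countN v
  SameSum-countN [] = refl
  SameSum-countN {x = a ∷ x} {b ∷ y} {c ∷ u} {e ∷ v} (p ∷ s) = begin
    (ind a + countN x) + (ind b + countN y) ≡⟨ interchange (ind a) (countN x) (ind b) (countN y) ⟩
    (ind a + ind b) + (countN x + countN y) ≡⟨ cong₂ _+_ p (SameSum-countN s) ⟩
    (ind c + ind e) + (countN u + countN v) ≡⟨ interchange (ind c) (countN u) (ind e) (countN v) ⟨
    (ind c + countN u) + (ind e + countN v) ∎

  raise-lower-sum : ∀ {d} (u v : Word d) → SameSum (raise u v) (lower u v) u v
  raise-lower-sum []          []          = []
  raise-lower-sum (false ∷ u) (true ∷ v)  = refl ∷ SameSum-refl u v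
  raise-lower-sum (false ∷ u) (false ∷ v) = refl ∷ raise-lower-sum u v
  raise-lower-sum (true ∷ u)  (true ∷ v)  = refl ∷ raise-lower-sum u v
  raise-lower-sum (true ∷ u)  (false ∷ v) = refl ∷ raise-lower-sum u v

  raise-countN : ∀ {d} (u v : Word d) → suc (countN u) ≤ countN v → countN (raise u v) ≡ suc (countN u)
  raise-countN (false ∷ u) (true ∷ v)  _  = refl
  raise-countN (false ∷ u) (false ∷ v) lt = raise-countN u v lt
  raise-countN (true ∷ u)  (true ∷ v)  lt = cong suc (raise-countN u v (≤-pred lt))
  raise-countN (true ∷ u)  (false ∷ v) lt = cong suc (raise-countN u v (≤-trans (n≤1+n _) lt))

  raise-fixed : ∀ {d} (u v : Word d) → suc (countN u) ≤ countN v → raise u v ≡ v → addsNᵇ u v ≡ true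
  raise-fixed (false ∷ u) (true ∷ v)  _  e = trans (cong (sameᵇ u) (sym (∷-injectiveʳ e))) (sameᵇ-refl u)
  raise-fixed (false ∷ u) (false ∷ v) lt e = raise-fixed u v lt (∷-injectiveʳ e)
  raise-fixed (true ∷ u)  (true ∷ v)  lt e = raise-fixed u v (≤-pred lt) (∷-injectiveʳ e)

  lower-fixed : ∀ {d} (u v : Word d) → suc (countN u) ≤ countN v → lower u v ≡ u → addsNᵇ u v ≡ true
  lower-fixed (false ∷ u) (true ∷ v)  _  e = trans (cong (λ z → sameᵇ z v) (sym (∷-injectiveʳ e))) (sameᵇ-refl v)
  lower-fixed (false ∷ u) (false ∷ v) lt e = lower-fixed u v lt (∷-injectiveʳ e)
  lower-fixed (true ∷ u)  (true ∷ v)  lt e = lower-fixed u v (≤-pred lt) (∷-injectiveʳ e)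

  RaiseLowerHeights : ∀ {d} → Word d → Word d → ℕ → Set
  RaiseLowerHeights u v k =
      ((prefixN k (raise u v) ≡ suc (prefixN k u)) × (suc (prefixN k (lower u v)) ≡ prefixN k v))
    ⊎ ((prefixN k (raise u v) ≡ prefixN k u) × (prefixN k (lower u v) ≡ prefixN k v) × (prefixN k v ≤ prefixN k u))

  raise-lower-heights : ∀ {d} (u v : Word d) k → RaiseLowerHeights u v k
  raise-lower-heights u           v           zero    = inj₂ (refl , refl , z≤n)
  raise-lower-heights []          []          (suc k) = inj₂ (refl , refl , z≤n)
  raise-lower-heights (false ∷ u) (true ∷ v)  (suc k) = inj₁ (refl , refl)
  raise-lower-heights (false ∷ u) (false ∷ v) (suc k) = raise-lower-heights u v k
  raise-lower-heights (true ∷ u)  (true ∷ v)  (suc k) with raise-lower-heights u v k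
  ... | inj₁ (r , l)     = inj₁ (cong suc r , cong suc l)
  ... | inj₂ (r , l , o) = inj₂ (cong suc r , cong suc l , s≤s o)
  raise-lower-heights (true ∷ u)  (false ∷ v) (suc k) with raise-lower-heights u v k
  ... | inj₁ (r , l)     = inj₁ (cong suc r , l)
  ... | inj₂ (r , l , o) = inj₂ (cong suc r , l , m≤n⇒m≤1+n o)

  PrefixBetween : ∀ {d} → Word d → Word d → Word d → ℕ → Set
  PrefixBetween u v x k =
      ((prefixN k u ≤ prefixN k x) × (prefixN k x ≤ prefixN k v))
    ⊎ ((prefixN k v ≤ prefixN k x) × (prefixN k x ≤ prefixN k u))

  PrefixBetween-atˡ : ∀ {d} (u v x : Word d) k → prefixN k x ≡ prefixN k u → PrefixBetween u v x k
  PrefixBetween-atˡ u v x k e with ≤-total (prefixN k u) (prefixN k v)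
  ... | inj₁ u≤v = inj₁ (≤-reflexive (sym e) , subst (_≤ prefixN k v) (sym e) u≤v)
  ... | inj₂ v≤u = inj₂ (subst (prefixN k v ≤_) (sym e) v≤u , ≤-reflexive e)

  PrefixBetween-swap : ∀ {d} (u v x : Word d) k → PrefixBetween u v x k → PrefixBetween v u x k
  PrefixBetween-swap u v x k (inj₁ p) = inj₂ p
  PrefixBetween-swap u v x k (inj₂ p) = inj₁ p

  PrefixBetween-atʳ : ∀ {d} (u v x : Word d) k → prefixN k x ≡ prefixN k v → PrefixBetween u v x k
  PrefixBetween-atʳ u v x k e = PrefixBetween-swap v u x k (PrefixBetween-atˡ v u x k e)

  PrefixBetween-∷ : ∀ {d} b (u v x : Word d) k → PrefixBetween u v x k → PrefixBetween (b ∷ u) (b ∷ v) (b ∷ x) (suc k)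
  PrefixBetween-∷ b u v x k (inj₁ (p , q)) = inj₁ (+-monoʳ-≤ (ind b) p , +-monoʳ-≤ (ind b) q)
  PrefixBetween-∷ b u v x k (inj₂ (p , q)) = inj₂ (+-monoʳ-≤ (ind b) p , +-monoʳ-≤ (ind b) q)

  record Exchange {d} (u v : Word d) : Set where
    field
      x y       : Word d
      x-between : ∀ k → PrefixBetween u v x k
      y-between : ∀ k → PrefixBetween u v y k
      x-countN  : countN x ≡ countN u
      y-countN  : countN y ≡ countN u
      x≢u       : x ≢ u
      x≢v       : x ≢ v
      y≢u       : y ≢ u
      y≢v       : y ≢ v
      sum       : SameSum x y u v

  Exchange-swap : ∀ {d} {u v : Word d} → countN u ≡ countN v → Exchange u v → Exchange v u
  Exchange-swap cnt r = record
    { x = x ; y = y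
    ; x-between = λ k → PrefixBetween-swap _ _ _ k (x-between k)
    ; y-between = λ k → PrefixBetween-swap _ _ _ k (y-between k)
    ; x-countN = trans x-countN cnt ; y-countN = trans y-countN cnt
    ; x≢u = x≢v ; x≢v = x≢u ; y≢u = y≢v ; y≢v = y≢u
    ; sum = SameSum-swap sum }
    where open Exchange r

  Exchange-∷ : ∀ {d} b {u v : Word d} → Exchange u v → Exchange (b ∷ u) (b ∷ v)
  Exchange-∷ b {u} {v} r = record
    { x = b ∷ x ; y = b ∷ y
    ; x-between = λ { zero → inj₁ (z≤n , z≤n) ; (suc k) → PrefixBetween-∷ b u v x k (x-between k) }
    ; y-between = λ { zero → inj₁ (z≤n , z≤n) ; (suc k) → PrefixBetween-∷ b u v y k (y-between k) }
    ; x-countN = cong (ind b +_) x-countN ; y-countN = cong (ind b +_) y-countN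
    ; x≢u = λ e → x≢u (∷-injectiveʳ e) ; x≢v = λ e → x≢v (∷-injectiveʳ e)
    ; y≢u = λ e → y≢u (∷-injectiveʳ e) ; y≢v = λ e → y≢v (∷-injectiveʳ e)
    ; sum = refl ∷ sum }
    where open Exchange r

  exchange-at : ∀ {d} (u v : Word d) → countN (true ∷ u) ≡ countN (false ∷ v) → addsNᵇ u v ≡ false →
                Exchange (true ∷ u) (false ∷ v)
  exchange-at u v cnt not-adds = record
    { x = false ∷ raise u v ; y = true ∷ lower u v
    ; x-between = x-between ; y-between = y-between
    ; x-countN = raise-countN u v more ; y-countN = cong suc lower-countN
    ; x≢u = λ () ; y≢v = λ ()
    ; x≢v = λ e → adds≢ (raise-fixed u v more (∷-injectiveʳ e))
    ; y≢u = λ e → adds≢ (lower-fixed u v more (∷-injectiveʳ e))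
    ; sum = refl ∷ raise-lower-sum u v }
    where
    more : suc (countN u) ≤ countN v
    more = ≤-reflexive cnt
    adds≢ : addsNᵇ u v ≢ true
    adds≢ e with trans (sym not-adds) e
    ... | ()
    lower-countN : countN (lower u v) ≡ countN u
    lower-countN = suc-injective (+-cancelˡ-≡ (countN u) _ _ (begin
      countN u + suc (countN (lower u v))     ≡⟨ +-suc (countN u) _ ⟩
      suc (countN u) + countN (lower u v)     ≡⟨ cong (_+ countN (lower u v)) (raise-countN u v more) ⟨
      countN (raise u v) + countN (lower u v) ≡⟨ SameSum-countN (raise-lower-sum u v) ⟩
      countN u + countN v                     ≡⟨ cong (countN u +_) cnt ⟨
      countN u + suc (countN u) ∎))
    x-between : ∀ k → PrefixBetween (true ∷ u) (false ∷ v) (false ∷ raise u v) k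
    x-between zero    = inj₁ (z≤n , z≤n)
    x-between (suc k) with raise-lower-heights u v k
    ... | inj₁ (r , _)     = PrefixBetween-atˡ (true ∷ u) (false ∷ v) (false ∷ raise u v) (suc k) r
    ... | inj₂ (r , _ , o) = inj₂ (subst (prefixN k v ≤_) (sym r) o , subst (_≤ suc (prefixN k u)) (sym r) (n≤1+n _))
    y-between : ∀ k → PrefixBetween (true ∷ u) (false ∷ v) (true ∷ lower u v) k
    y-between zero    = inj₁ (z≤n , z≤n)
    y-between (suc k) with raise-lower-heights u v k
    ... | inj₁ (_ , l)     = PrefixBetween-atʳ (true ∷ u) (false ∷ v) (true ∷ lower u v) (suc k) l
    ... | inj₂ (_ , l , o) = inj₂ (subst (λ z → prefixN k v ≤ suc z) (sym l) (n≤1+n _) ,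
                                   s≤s (subst (_≤ prefixN k u) (sym l) o))

  exchange : ∀ {d} (u v : Word d) → u ≢ v → countN u ≡ countN v →
             movesNᵇ u v ≡ false → movesNᵇ v u ≡ false → Exchange u v
  exchange []          []          u≢v _   _  _  = ⊥-elim (u≢v refl)
  exchange (true ∷ u)  (false ∷ v) _   cnt uv _  = exchange-at u v cnt uv
  exchange (false ∷ u) (true ∷ v)  _   cnt _  vu = Exchange-swap (sym cnt) (exchange-at v u (sym cnt) vu)
  exchange (false ∷ u) (false ∷ v) u≢v cnt uv vu =
    Exchange-∷ false (exchange u v (λ e → u≢v (cong (false ∷_) e)) cnt uv vu)
  exchange (true ∷ u)  (true ∷ v)  u≢v cnt uv vu =
    Exchange-∷ true (exchange u v (λ e → u≢v (cong (true ∷_) e)) (suc-injective cnt) uv vu)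

-- A move u → v always spans an edge, cut out by the functional
-- χ u + χ v (its value at x is common u x + common v x).  Conversely, if V
-- is closed under taking words whose paths lie between two of its members,
-- every edge comes from a move: otherwise the exchange words x, y would
-- satisfy χ x + χ y = χ u + χ v while scoring strictly less than u and v.
module Edges where
  open Sums using (ind)
  open Moves
  open Exchange
  open import Data.Bool using (Bool; true; false; _∨_)
  open import Data.Nat as ℕ using (ℕ)
  open import Data.Nat.Properties as ℕ using ()
  open import Data.Integer using (ℤ; +_; _+_; _*_; _<_; +<+)
  open import Data.Integer.Properties using (pos-+; <-irrefl; +-mono-<)
  open import Data.Integer.Tactic.RingSolver using (solve-∀)
  open import Data.Vec using (Vec; []; _∷_; zipWith)
  open import Data.Product using (_,_)
  open import Data.Empty using (⊥-elim)
  open import Relation.Binary.PropositionalEquality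
  open ≡-Reasoning

  χ-∷ : ∀ {d} b (x : Word d) → χ (b ∷ x) ≡ (+ ind b) ∷ χ x
  χ-∷ false x = refl
  χ-∷ true  x = refl

  dot-χ : ∀ {d} (u x : Word d) → dot (χ u) (χ x) ≡ + common u x
  dot-χ []          []          = refl
  dot-χ (true ∷ u)  (true ∷ x)  = cong (λ z → + 1 + z) (dot-χ u x)
  dot-χ (true ∷ u)  (false ∷ x) = cong (λ z → + 0 + z) (dot-χ u x)
  dot-χ (false ∷ u) (true ∷ x)  = cong (λ z → + 0 + z) (dot-χ u x)
  dot-χ (false ∷ u) (false ∷ x) = cong (λ z → + 0 + z) (dot-χ u x)

  dot-+ : ∀ {d} (a b c : Vec ℤ d) → dot (zipWith _+_ a b) c ≡ dot a c + dot b c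
  dot-+ []       []       []       = refl
  dot-+ (a ∷ as) (b ∷ bs) (c ∷ cs) =
    trans (cong (λ z → (a + b) * c + z) (dot-+ as bs cs)) (regroup a b c (dot as cs) (dot bs cs))
    where
    regroup : ∀ a b c A B → (a + b) * c + (A + B) ≡ (a * c + A) + (b * c + B)
    regroup = solve-∀

  dot-pair : ∀ {d} (u v x : Word d) → dot (zipWith _+_ (χ u) (χ v)) (χ x) ≡ + (common u x ℕ.+ common v x)
  dot-pair u v x =
    trans (dot-+ (χ u) (χ v) (χ x)) (trans (cong₂ _+_ (dot-χ u x) (dot-χ v x)) (sym (pos-+ (common u x) (common v x))))

  dot-SameSum : ∀ {d} {x y u v : Word d} → SameSum x y u v →
                ∀ w → dot w (χ x) + dot w (χ y) ≡ dot w (χ u) + dot w (χ v)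
  dot-SameSum [] [] = refl
  dot-SameSum {x = a ∷ x} {b ∷ y} {c ∷ u} {e ∷ v} (p ∷ s) (w₀ ∷ w) = begin
    dot (w₀ ∷ w) (χ (a ∷ x)) + dot (w₀ ∷ w) (χ (b ∷ y))
      ≡⟨ cong₂ (λ s t → dot (w₀ ∷ w) s + dot (w₀ ∷ w) t) (χ-∷ a x) (χ-∷ b y) ⟩
    (w₀ * + ind a + dot w (χ x)) + (w₀ * + ind b + dot w (χ y))
      ≡⟨ regroup w₀ (+ ind a) (+ ind b) _ _ ⟩
    w₀ * (+ ind a + + ind b) + (dot w (χ x) + dot w (χ y))
      ≡⟨ cong₂ (λ s t → w₀ * s + t) (trans (sym (pos-+ (ind a) (ind b))) (trans (cong +_ p) (pos-+ (ind c) (ind e))))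
               (dot-SameSum s w) ⟩
    w₀ * (+ ind c + + ind e) + (dot w (χ u) + dot w (χ v))
      ≡⟨ regroup w₀ (+ ind c) (+ ind e) _ _ ⟨
    (w₀ * + ind c + dot w (χ u)) + (w₀ * + ind e + dot w (χ v))
      ≡⟨ cong₂ (λ s t → dot (w₀ ∷ w) s + dot (w₀ ∷ w) t) (χ-∷ c u) (χ-∷ e v) ⟨
    dot (w₀ ∷ w) (χ (c ∷ u)) + dot (w₀ ∷ w) (χ (e ∷ v)) ∎
    where
    regroup : ∀ w a b X Y → (w * a + X) + (w * b + Y) ≡ w * (a + b) + (X + Y)
    regroup = solve-∀

  module _ {d} (V : Word d → Set) (m : ℕ) (rank : ∀ x → V x → countN x ≡ m) where

    -- A move spans an edge: the functional χ u + χ v takes the value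
    -- m + (m - 1) at u and v, and at most (m - 1) + (m - 1) elsewhere.
    move⇒edge : ∀ u v → V u → V v → movesNᵇ u v ≡ true → IsEdge V u v
    move⇒edge u v Vu Vv move = Vu , Vv , u≢v , w , tie , strict
      where
      u≢v : u ≢ v
      u≢v e with trans (sym move) (trans (cong (movesNᵇ u) (sym e)) (movesNᵇ-irrefl u))
      ... | ()
      w = zipWith _+_ (χ u) (χ v)
      same : countN u ≡ countN v
      same = movesNᵇ-countN u v move
      at-u : dot w (χ u) ≡ + (countN u ℕ.+ common u v)
      at-u = trans (dot-pair u v u) (cong₂ (λ p q → + (p ℕ.+ q)) (common-self u) (common-sym v u))
      tie : dot w (χ u) ≡ dot w (χ v)
      tie = trans at-u (trans (cong +_ (trans (ℕ.+-comm (countN u) _) (cong (common u v ℕ.+_) same)))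
                              (sym (trans (dot-pair u v v) (cong (λ q → + (common u v ℕ.+ q)) (common-self v)))))
      strict : ∀ x → V x → x ≢ u → x ≢ v → dot w (χ x) < dot w (χ u)
      strict x Vx x≢u x≢v = subst₂ _<_ (sym (dot-pair u v x)) (sym at-u) (+<+ (ℕ.+-mono-<-≤ below-u below-v))
        where
        cnt : countN x ≡ countN u
        cnt = trans (rank x Vx) (sym (rank u Vu))
        below-u : common u x ℕ.< countN u
        below-u = common-< u x cnt x≢u
        below-v : common v x ℕ.≤ common u v
        below-v = ℕ.≤-pred (subst (common v x ℕ.<_) (trans (sym same) (sym (movesNᵇ-common u v move)))
                                  (common-< v x (trans cnt same) x≢v))

    edge-sym : ∀ u v → IsEdge V v u → IsEdge V u v
    edge-sym u v (Vv , Vu , v≢u , w , tie , strict) =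
      Vu , Vv , (λ e → v≢u (sym e)) , w , sym tie , λ x Vx x≢u x≢v → subst (dot w (χ x) <_) tie (strict x Vx x≢v x≢u)

    module _ (convex : ∀ u v x → V u → V v → (∀ k → PrefixBetween u v x k) → countN x ≡ countN u → V x) where

      edge⇒move : ∀ u v → IsEdge V u v → (movesNᵇ u v ∨ movesNᵇ v u) ≡ true
      edge⇒move u v (Vu , Vv , u≢v , w , tie , strict) with movesNᵇ u v in uv | movesNᵇ v u in vu
      ... | true  | _    = refl
      ... | false | true = refl
      ... | false | false = ⊥-elim (<-irrefl refl contradiction)
        where
        open Exchange.Exchange (exchange u v u≢v (trans (rank u Vu) (sym (rank v Vv))) uv vu)
        Vx = convex u v x Vu Vv x-between x-countN
        Vy = convex u v y Vu Vv y-between y-countN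
        smaller : dot w (χ x) + dot w (χ y) < dot w (χ u) + dot w (χ v)
        smaller = subst (λ z → dot w (χ x) + dot w (χ y) < dot w (χ u) + z) tie
                        (+-mono-< (strict x Vx x≢u x≢v) (strict y Vy y≢u y≢v))
        contradiction : dot w (χ u) + dot w (χ v) < dot w (χ u) + dot w (χ v)
        contradiction = subst (_< dot w (χ u) + dot w (χ v)) (dot-SameSum sum w) smaller

module LatticePathMatroid where
  open Exchange using (PrefixBetween)
  open import Data.Nat using (_+_; _≤_)
  open import Data.Nat.Properties using (≤-trans)
  open import Data.Product using (_×_; _,_; proj₁; proj₂)
  open import Data.Sum using (inj₁; inj₂)
  open import Relation.Binary.PropositionalEquality

  basis-rank : ∀ {m r P Q} (x : Word (m + r)) → IsBasis m r P Q x → countN x ≡ r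
  basis-rank x = proj₁

  basis-convex : ∀ {m r P Q} (u v x : Word (m + r)) → IsBasis m r P Q u → IsBasis m r P Q v →
                 (∀ k → PrefixBetween u v x k) → countN x ≡ countN u → IsBasis m r P Q x
  basis-convex {m} {r} {P} {Q} u v x (cu , Bu) (cv , Bv) between cx =
    trans cx cu , λ k k≤ → squeeze k k≤ (between k)
    where
    squeeze : ∀ k → k ≤ m + r → PrefixBetween u v x k →
              (prefixN k P ≤ prefixN k x) × (prefixN k x ≤ prefixN k Q)
    squeeze k k≤ (inj₁ (ux , xv)) = ≤-trans (proj₁ (Bu k k≤)) ux , ≤-trans xv (proj₂ (Bv k k≤))
    squeeze k k≤ (inj₂ (vx , xu)) = ≤-trans (proj₁ (Bv k k≤)) vx , ≤-trans xu (proj₂ (Bu k k≤))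

-- After k steps the
-- lower path EⁿNⁿ has height k ∸ n and the upper path (EN)ⁿ height ⌊k/2⌋;
-- a word with n N steps automatically stays above the lower path, and it
-- stays below the upper one iff twice its height never exceeds k, which is
-- what belowAux checks step by step.
module CatalanMatroid where
  open Sums using (ind)
  open Words
  open import Data.Bool using (Bool; true; false; T)
  open import Data.Bool.Properties using (T-∧; T-≡)
  open import Data.Nat using (ℕ; zero; suc; _+_; _∸_; _≤_; _≤ᵇ_; _≡ᵇ_; z≤n; s≤s; _≤?_)
  open import Data.Nat.Properties using (+-comm; +-assoc; +-suc; +-identityʳ; ≤-trans; ≤-pred;
    n≤1+n; m≤n⇒m≤1+n; m≤m+n; +-mono-≤; +-monoʳ-≤; +-monoˡ-≤; +-cancelʳ-≤; ≤ᵇ⇒≤; ≤⇒≤ᵇ; ≡ᵇ⇒≡; ≡⇒≡ᵇ;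
    ≰⇒>; <-irrefl; 0∸n≡0; +-∸-assoc; m≤n⇒m∸n≡0; m∸n+n≡m; m≤n+o⇒m∸n≤o)
  open import Data.Nat.DivMod using (_%_; [m+n]%n≡m%n)
  open import Data.Fin using (toℕ)
  open import Data.Vec using ([]; _∷_; tabulate)
  open import Data.Product using (_×_; _,_; proj₁; proj₂)
  open import Data.Empty using (⊥-elim)
  open import Function.Bundles using (Equivalence)
  open import Relation.Nullary using (¬_; yes; no)
  open import Relation.Binary.PropositionalEquality

  countBelow : (ℕ → Bool) → ℕ → ℕ
  countBelow φ zero    = 0
  countBelow φ (suc k) = countBelow φ k + ind (φ k)

  countBelow-shift : ∀ φ k → countBelow φ (suc k) ≡ ind (φ 0) + countBelow (λ i → φ (suc i)) k
  countBelow-shift φ zero    = +-comm 0 (ind (φ 0))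
  countBelow-shift φ (suc k) = trans (cong (_+ ind (φ (suc k))) (countBelow-shift φ k)) (+-assoc (ind (φ 0)) _ _)

  prefixN-tabulate : ∀ d (φ : ℕ → Bool) k → k ≤ d →
                     prefixN k (tabulate {n = d} (λ i → φ (toℕ i))) ≡ countBelow φ k
  prefixN-tabulate d       φ zero    _       = refl
  prefixN-tabulate (suc d) φ (suc k) (s≤s k≤d) =
    trans (cong (ind (φ 0) +_) (prefixN-tabulate d (λ i → φ (suc i)) k k≤d)) (sym (countBelow-shift φ k))

  countBelow-threshold : ∀ n k → countBelow (n ≤ᵇ_) k ≡ k ∸ n
  countBelow-threshold n zero    = sym (0∸n≡0 n)
  countBelow-threshold n (suc k) with n ≤? k
  ... | yes n≤k = trans (cong₂ _+_ (countBelow-threshold n k) (cong ind (Equivalence.to T-≡ (≤⇒≤ᵇ n≤k))))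
                        (trans (+-comm (k ∸ n) 1) (sym (+-∸-assoc 1 n≤k)))
  ... | no  n≰k = trans (cong₂ _+_ (countBelow-threshold n k) (cong ind (not-T (λ t → n≰k (≤ᵇ⇒≤ n k t)))))
                        (trans (+-identityʳ _) (trans (m≤n⇒m∸n≡0 (≤-trans (n≤1+n k) k<n)) (sym (m≤n⇒m∸n≡0 k<n))))
    where
    k<n = ≰⇒> n≰k
    not-T : ∀ {b} → ¬ T b → b ≡ false
    not-T {false} _ = refl
    not-T {true}  f = ⊥-elim (f _)

  prefixN-EⁿNⁿ : ∀ n k → k ≤ n + n → prefixN k (EⁿNⁿ n) ≡ k ∸ n
  prefixN-EⁿNⁿ n k k≤ = trans (prefixN-tabulate (n + n) (n ≤ᵇ_) k k≤) (countBelow-threshold n k)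

  odd : ℕ → Bool
  odd i = i % 2 ≡ᵇ 1

  odd-step : ∀ i → odd (suc (suc i)) ≡ odd i
  odd-step i = cong (_≡ᵇ 1) (trans (cong (_% 2) (+-comm 2 i)) ([m+n]%n≡m%n i 2))

  odd-pair : ∀ i → ind (odd i) + ind (odd (suc i)) ≡ 1
  odd-pair zero          = refl
  odd-pair (suc zero)    = refl
  odd-pair (suc (suc i)) rewrite odd-step i | odd-step (suc i) = odd-pair i

  countBelow-odd-step : ∀ k → countBelow odd (suc (suc k)) ≡ suc (countBelow odd k)
  countBelow-odd-step k =
    trans (+-assoc (countBelow odd k) (ind (odd k)) _) (trans (cong (countBelow odd k +_) (odd-pair k)) (+-comm _ 1))

  countBelow-odd : ∀ k → (countBelow odd k + countBelow odd k ≤ k) × (k ≤ suc (countBelow odd k + countBelow odd k))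
  countBelow-odd zero          = z≤n , z≤n
  countBelow-odd (suc zero)    = z≤n , s≤s z≤n
  countBelow-odd (suc (suc k)) rewrite countBelow-odd-step k with countBelow-odd k
  ... | lo , hi = s≤s (subst (_≤ suc k) (sym (+-suc q q)) (s≤s lo)) , s≤s (s≤s (subst (k ≤_) (sym (+-suc q q)) hi))
    where q = countBelow odd k

  prefixN-[EN]ⁿ : ∀ n k → k ≤ n + n → prefixN k ([EN]ⁿ n) ≡ countBelow odd k
  prefixN-[EN]ⁿ n k k≤ = prefixN-tabulate (n + n) odd k k≤

  shift : ∀ h p → h + (suc p + suc p) ≡ suc (suc h + (p + p))
  shift h p = trans (+-suc h (p + suc p)) (cong suc (trans (cong (h +_) (+-suc p p)) (+-suc h (p + p))))

  belowAux⇒prefix : ∀ {d} e h (w : Word d) → h ≤ e → T (belowAux e h w) →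
                    ∀ k → h + (prefixN k w + prefixN k w) ≤ e + k
  belowAux⇒prefix e h w           h≤e t zero    = subst₂ _≤_ (sym (+-identityʳ h)) (sym (+-identityʳ e)) h≤e
  belowAux⇒prefix e h []          h≤e t (suc k) =
    subst (_≤ e + suc k) (sym (+-identityʳ h)) (≤-trans h≤e (m≤m+n e (suc k)))
  belowAux⇒prefix e h (false ∷ w) h≤e t (suc k) =
    subst (h + (prefixN k w + prefixN k w) ≤_) (sym (+-suc e k)) (belowAux⇒prefix (suc e) h w (m≤n⇒m≤1+n h≤e) t k)
  belowAux⇒prefix e h (true ∷ w)  h≤e t (suc k) with T-∧⁻ {suc h ≤ᵇ e} t
  ... | step , rest = subst₂ _≤_ (sym (shift h (prefixN k w))) (sym (+-suc e k))
                             (s≤s (belowAux⇒prefix e (suc h) w (≤ᵇ⇒≤ (suc h) e step) rest k))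

  prefix⇒belowAux : ∀ {d} e h (w : Word d) → (∀ k → k ≤ d → h + (prefixN k w + prefixN k w) ≤ e + k) →
                    T (belowAux e h w)
  prefix⇒belowAux e h []          _ = _
  prefix⇒belowAux e h (false ∷ w) bound =
    prefix⇒belowAux (suc e) h w
      (λ k k≤ → subst (h + (prefixN k w + prefixN k w) ≤_) (+-suc e k) (bound (suc k) (s≤s k≤)))
  prefix⇒belowAux e h (true ∷ w)  bound = Equivalence.from T-∧ (≤⇒≤ᵇ first , prefix⇒belowAux e (suc h) w rest)
    where
    rest : ∀ k → k ≤ _ → suc h + (prefixN k w + prefixN k w) ≤ e + k
    rest k k≤ = ≤-pred (subst₂ _≤_ (shift h (prefixN k w)) (+-suc e k) (bound (suc k) (s≤s k≤)))
    first : suc h ≤ e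
    first = subst (_≤ e) (cong suc (+-identityʳ h))
                  (≤-pred (subst₂ _≤_ (shift h 0) (+-comm e 1) (bound 1 (s≤s z≤n))))

  halve : ∀ p q k → p + p ≤ k → k ≤ suc (q + q) → p ≤ q
  halve p q k lo hi with p ≤? q
  ... | yes p≤q = p≤q
  ... | no  p≰q = ⊥-elim (<-irrefl refl (≤-trans (subst (_≤ p + p) (cong suc (+-suc q q))
                                                          (+-mono-≤ (≰⇒> p≰q) (≰⇒> p≰q)))
                                                  (≤-trans lo hi)))

  countN-≤ : ∀ {d} (w : Word d) k → countN w ≤ prefixN k w + (d ∸ k)
  countN-≤ {d} w zero    = subst (countN w ≤_) (countN+countE w) (m≤m+n (countN w) (countE w))
  countN-≤     []      (suc k) = z≤n
  countN-≤     (b ∷ w) (suc k) =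
    subst (ind b + countN w ≤_) (sym (+-assoc (ind b) _ _)) (+-monoʳ-≤ (ind b) (countN-≤ w k))

  module _ (n : ℕ) where

    Basis : Word (n + n) → Set
    Basis = IsBasis n n (EⁿNⁿ n) ([EN]ⁿ n)

    -- A subdiagonal word is a basis: its height after k steps is at least
    -- k ∸ n (the remaining steps hold at most 2n ∸ k of its n N steps) and at
    -- most ⌊k/2⌋.
    subdiagonal⇒basis : ∀ w → T (isSubdiagonal n w) → Basis w
    subdiagonal⇒basis w t = cnt , λ k k≤ → above k k≤ , below k k≤
      where
      cnt : countN w ≡ n
      cnt = ≡ᵇ⇒≡ (countN w) n (proj₁ (T-∧⁻ t))
      above : ∀ k → k ≤ n + n → prefixN k (EⁿNⁿ n) ≤ prefixN k w
      above k k≤ = subst (_≤ prefixN k w) (sym (prefixN-EⁿNⁿ n k k≤))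
                         (m≤n+o⇒m∸n≤o k n (subst (k ≤_) (+-comm (prefixN k w) n) k≤h+n))
        where
        rest : n ≤ prefixN k w + ((n + n) ∸ k)
        rest = subst (_≤ prefixN k w + ((n + n) ∸ k)) cnt (countN-≤ w k)
        k≤h+n : k ≤ prefixN k w + n
        k≤h+n = +-cancelʳ-≤ n k (prefixN k w + n)
                  (subst₂ _≤_ (+-comm n k)
                          (trans (+-assoc (prefixN k w) ((n + n) ∸ k) k)
                                 (trans (cong (prefixN k w +_) (m∸n+n≡m k≤)) (sym (+-assoc (prefixN k w) n n))))
                          (+-monoˡ-≤ k rest))
      below : ∀ k → k ≤ n + n → prefixN k w ≤ prefixN k ([EN]ⁿ n)
      below k k≤ = subst (prefixN k w ≤_) (sym (prefixN-[EN]ⁿ n k k≤))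
                         (halve (prefixN k w) (countBelow odd k) k (belowAux⇒prefix 0 0 w z≤n (proj₂ (T-∧⁻ t)) k)
                                (proj₂ (countBelow-odd k)))

    basis⇒subdiagonal : ∀ w → Basis w → T (isSubdiagonal n w)
    basis⇒subdiagonal w (cnt , between) =
      Equivalence.from T-∧ (≡⇒≡ᵇ (countN w) n cnt , prefix⇒belowAux 0 0 w twice-below)
      where
      below : ∀ k → k ≤ n + n → prefixN k w ≤ countBelow odd k
      below k k≤ = subst (prefixN k w ≤_) (prefixN-[EN]ⁿ n k k≤) (proj₂ (between k k≤))
      twice-below : ∀ k → k ≤ n + n → prefixN k w + prefixN k w ≤ k
      twice-below k k≤ = ≤-trans (+-mono-≤ (below k k≤) (below k k≤)) (proj₁ (countBelow-odd k))

-- By the edge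
-- characterisation, the ordered pairs spanning an edge are the pairs of
-- subdiagonal words related by a move in one direction or the other; moves
-- keep a path subdiagonal, and the moves out of u are counted by area u, so
-- there are 2 Σ_u area u = 2 a(n) such pairs.
module EdgeCount where
  open Sums
  open Words using (T-∧⁻)
  open BallotWords using (a≡areaSum)
  open Moves
  open Edges
  open LatticePathMatroid
  open CatalanMatroid
  open import Data.Bool using (Bool; true; false; if_then_else_; _∧_; _∨_; T)
  open import Data.Bool.Properties using (T?; T-∧; T-≡)
  open import Data.Nat using (ℕ; zero; suc; _+_; _*_; _≤_; _≤ᵇ_; _≡ᵇ_; s≤s)
  open import Data.Nat.Properties using (+-identityʳ; ≤-trans; n≤1+n; m≤n⇒m≤1+n; ≤ᵇ⇒≤; ≤⇒≤ᵇ)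
  open import Data.Vec using ([]; _∷_)
  open import Data.Vec.Properties using (∷-injectiveʳ)
  open import Data.List using (List; _∷_; map; filter; length; cartesianProduct)
  open import Data.List.Membership.Propositional using (_∈_)
  open import Data.List.Membership.Propositional.Properties
    using (∈-filter⁺; ∈-filter⁻; ∈-cartesianProduct⁺; ∈-map⁺; ∈-map⁻; ∈-++⁺ˡ; ∈-++⁺ʳ)
  open import Data.List.Relation.Unary.Any using (here)
  open import Data.List.Relation.Unary.Unique.Propositional using (Unique)
  open import Data.List.Relation.Unary.Unique.Propositional.Properties using (filter⁺; cartesianProduct⁺; ++⁺; map⁺)
  open import Data.List.Relation.Unary.AllPairs using ([]; _∷_)
  open import Data.List.Relation.Unary.All using ([])
  open import Data.Product using (_×_; _,_; proj₁; proj₂)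
  open import Data.Sum using (_⊎_; inj₁; inj₂)
  open import Data.Empty using (⊥)
  open import Function.Bundles using (_⇔_; mk⇔; Equivalence)
  open import Relation.Binary.PropositionalEquality
  open ≡-Reasoning

  allWords-complete : ∀ {d} (w : Word d) → w ∈ allWords d
  allWords-complete []          = here refl
  allWords-complete (false ∷ w) = ∈-++⁺ˡ (∈-map⁺ (false ∷_) (allWords-complete w))
  allWords-complete {suc d} (true ∷ w) =
    ∈-++⁺ʳ (map (false ∷_) (allWords d)) (∈-map⁺ (true ∷_) (allWords-complete w))

  allWords-unique : ∀ d → Unique (allWords d)
  allWords-unique zero    = [] ∷ []
  allWords-unique (suc d) =
    ++⁺ (map⁺ ∷-injectiveʳ (allWords-unique d)) (map⁺ ∷-injectiveʳ (allWords-unique d)) disjoint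
    where
    disjoint : ∀ {w} → (w ∈ map (false ∷_) (allWords d)) × (w ∈ map (true ∷_) (allWords d)) → ⊥
    disjoint (p , q) with ∈-map⁻ (false ∷_) p | ∈-map⁻ (true ∷_) q
    ... | _ , _ , refl | _ , _ , ()

  addsNᵇ-below : ∀ {d} (u v : Word d) e h → addsNᵇ u v ≡ true → suc h ≤ e →
                 T (belowAux e (suc h) u) → T (belowAux (suc e) h v)
  addsNᵇ-below [] [] e h () h<e t
  addsNᵇ-below (false ∷ u) (true ∷ v)  e h adds h<e t rewrite sameᵇ-sound u v adds =
    Equivalence.from T-∧ (≤⇒≤ᵇ (s≤s (≤-trans (n≤1+n h) h<e)) , t)
  addsNᵇ-below (false ∷ u) (false ∷ v) e h adds h<e t = addsNᵇ-below u v (suc e) h adds (m≤n⇒m≤1+n h<e) t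
  addsNᵇ-below (true ∷ u)  (true ∷ v)  e h adds h<e t with T-∧⁻ {suc (suc h) ≤ᵇ e} t
  ... | step , rest = Equivalence.from T-∧ (≤⇒≤ᵇ (s≤s (≤-trans (n≤1+n h) h<e)) ,
                                             addsNᵇ-below u v e (suc h) adds (≤ᵇ⇒≤ (suc (suc h)) e step) rest)

  movesNᵇ-below : ∀ {d} (u v : Word d) e h → movesNᵇ u v ≡ true → T (belowAux e h u) → T (belowAux e h v)
  movesNᵇ-below [] [] e h () t
  movesNᵇ-below (false ∷ u) (false ∷ v) e h move t = movesNᵇ-below u v (suc e) h move t
  movesNᵇ-below (true ∷ u)  (true ∷ v)  e h move t with T-∧⁻ {suc h ≤ᵇ e} t
  ... | step , rest = Equivalence.from T-∧ (step , movesNᵇ-below u v e (suc h) move rest)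
  movesNᵇ-below (true ∷ u)  (false ∷ v) e h move t with T-∧⁻ {suc h ≤ᵇ e} t
  ... | step , rest = addsNᵇ-below u v e h move (≤ᵇ⇒≤ (suc h) e step) rest

  movesNᵇ-subdiagonal : ∀ n (u v : Word (n + n)) → movesNᵇ u v ≡ true →
                        T (isSubdiagonal n u) → T (isSubdiagonal n v)
  movesNᵇ-subdiagonal n u v move t with T-∧⁻ {countN u ≡ᵇ n} t
  ... | cnt , below = Equivalence.from T-∧ (subst (λ c → T (c ≡ᵇ n)) (movesNᵇ-countN u v move) cnt ,
                                            movesNᵇ-below u v 0 0 move below)

  -- Exactly one direction of a move can hold, so the indicator of the
  -- symmetric edge condition splits into the two directed ones.
  ind-∨ : ∀ a b → (a ≡ true → b ≡ false) → ind (a ∨ b) ≡ ind a + ind b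
  ind-∨ true  b     excl = sym (cong (λ x → 1 + ind x) (excl refl))
  ind-∨ false b     excl = refl

  ind-split : ∀ p q a b → (a ≡ true → b ≡ false) →
              ind (p ∧ (q ∧ (a ∨ b))) ≡ ind (p ∧ (q ∧ a)) + ind (q ∧ (p ∧ b))
  ind-split false false a b excl = refl
  ind-split false true  a b excl = refl
  ind-split true  false a b excl = refl
  ind-split true  true  a b excl = ind-∨ a b excl

  T-∨⁻ : ∀ {a b} → T (a ∨ b) → T a ⊎ T b
  T-∨⁻ {true}  t = inj₁ t
  T-∨⁻ {false} t = inj₂ t

  module _ (n : ℕ) where

    edgeᵇ : Word (n + n) → Word (n + n) → Bool
    edgeᵇ u v = isSubdiagonal n u ∧ (isSubdiagonal n v ∧ (movesNᵇ u v ∨ movesNᵇ v u))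

    edgeList : List (Word (n + n) × Word (n + n))
    edgeList = filter (λ p → T? (edgeᵇ (proj₁ p) (proj₂ p))) (cartesianProduct (allWords (n + n)) (allWords (n + n)))

    edgeList-unique : Unique edgeList
    edgeList-unique = filter⁺ _ (cartesianProduct⁺ (allWords-unique (n + n)) (allWords-unique (n + n)))

    edgeList-edges : ∀ u v → ((u , v) ∈ edgeList) ⇔ IsEdge (Basis n) u v
    edgeList-edges u v = mk⇔ to from
      where
      to : (u , v) ∈ edgeList → IsEdge (Basis n) u v
      to m with T-∧⁻ (proj₂ (∈-filter⁻ (λ p → T? (edgeᵇ (proj₁ p) (proj₂ p)))
                                    {xs = cartesianProduct (allWords (n + n)) (allWords (n + n))} m))
      ... | Du , rest with T-∧⁻ rest
      ... | Dv , moved with T-∨⁻ moved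
      ... | inj₁ uv = move⇒edge (Basis n) n basis-rank u v (subdiagonal⇒basis n u Du) (subdiagonal⇒basis n v Dv)
                                (Equivalence.to T-≡ uv)
      ... | inj₂ vu = edge-sym (Basis n) n basis-rank u v
                        (move⇒edge (Basis n) n basis-rank v u (subdiagonal⇒basis n v Dv) (subdiagonal⇒basis n u Du)
                                   (Equivalence.to T-≡ vu))
      from : IsEdge (Basis n) u v → (u , v) ∈ edgeList
      from e@(Bu , Bv , _) =
        ∈-filter⁺ (λ p → T? (edgeᵇ (proj₁ p) (proj₂ p)))
                  (∈-cartesianProduct⁺ (allWords-complete u) (allWords-complete v))
                  (Equivalence.from T-∧ (basis⇒subdiagonal n u Bu , Equivalence.from T-∧ (basis⇒subdiagonal n v Bv ,
                    Equivalence.from T-≡ (edge⇒move (Basis n) n basis-rank basis-convex u v e))))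

    moveInd : Word (n + n) → Word (n + n) → ℕ
    moveInd u v = ind (isSubdiagonal n u ∧ (isSubdiagonal n v ∧ movesNᵇ u v))

    moves-out : ∀ u → ∑ (allWords (n + n)) (moveInd u) ≡ (if isSubdiagonal n u then area u else 0)
    moves-out u with isSubdiagonal n u in Du
    ... | false = ∑-zero (allWords (n + n))
    ... | true  = trans (∑-cong (allWords (n + n)) target-subdiagonal) (count-movesNᵇ u)
      where
      target-subdiagonal : ∀ v → ind (isSubdiagonal n v ∧ movesNᵇ u v) ≡ ind (movesNᵇ u v)
      target-subdiagonal v with movesNᵇ u v in uv
      ... | true  = cong (λ b → ind (b ∧ true))
                         (Equivalence.to T-≡ (movesNᵇ-subdiagonal n u v uv (Equivalence.from T-≡ Du)))
      ... | false with isSubdiagonal n v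
      ...   | true  = refl
      ...   | false = refl

    -- Each edge is counted once from each end, and the directed edges out of
    -- the subdiagonal words sum to a(n).
    edgeList-length : length edgeList ≡ 2 * a n
    edgeList-length = begin
      length edgeList
        ≡⟨ length-filter (λ p → edgeᵇ (proj₁ p) (proj₂ p)) (cartesianProduct W W) ⟩
      ∑ (cartesianProduct W W) (λ p → ind (edgeᵇ (proj₁ p) (proj₂ p)))
        ≡⟨ ∑-cartesianProduct W W _ ⟩
      ∑ W (λ u → ∑ W (λ v → ind (edgeᵇ u v)))
        ≡⟨ ∑-cong W (λ u → ∑-cong W (λ v →
             ind-split (isSubdiagonal n u) (isSubdiagonal n v) _ _ (movesNᵇ-asym u v))) ⟩
      ∑ W (λ u → ∑ W (λ v → moveInd u v + moveInd v u))
        ≡⟨ ∑-cong W (λ u → ∑-+ W (moveInd u) (λ v → moveInd v u)) ⟩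
      ∑ W (λ u → ∑ W (moveInd u) + ∑ W (λ v → moveInd v u))
        ≡⟨ ∑-+ W _ _ ⟩
      S + ∑ W (λ u → ∑ W (λ v → moveInd v u))
        ≡⟨ cong (S +_) (∑-swap W W (λ u v → moveInd v u)) ⟩
      S + S
        ≡⟨ cong (S +_) (+-identityʳ S) ⟨
      2 * S
        ≡⟨ cong (2 *_) (trans (∑-cong W moves-out) (sym (a≡areaSum n))) ⟩
      2 * a n ∎
      where
      W = allWords (n + n)
      S = ∑ W (λ u → ∑ W (moveInd u))

    catalan-edge-count : HasEdgeCount (Basis n) (a n)
    catalan-edge-count = edgeList , edgeList-unique , edgeList-edges , edgeList-length

open import Data.Nat using (ℕ; suc; _+_; _*_; _^_; _≤_)
open import Data.Nat.Combinatorics using (_C_)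
open import Data.Integer using (+_)
open import Data.Rational using (ℚ; _/_)
open import Data.Rational as ℚ using ()
open import Data.Product using (_×_; _,_)
open import Relation.Binary.PropositionalEquality using (_≡_)
open EdgeCount using (catalan-edge-count)
open AreaFormula using (a-formula)

mainTheorem4 : ∀ (n : ℕ) → 1 ≤ n →
    HasEdgeCount (IsBasis n n (EⁿNⁿ n) ([EN]ⁿ n)) (a n)
  × ((+ a n) / 1
      ≡ (((+ (n * n)) / 2) ℚ.* ((+ 1) / suc n) ℚ.* ((+ ((2 * n) C n)) / 1))
        ℚ.- ((+ (4 ^ n)) / 2)
        ℚ.+ (((+ 1) / 4) ℚ.* ((+ ((2 * n + 2) C (n + 1))) / 1)))
mainTheorem4 n _ = catalan-edge-count n , a-formula n
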